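{- Let $v, v'$ be two distinct integers, let $p_1 \geq \cdots \geq p_k \geq \max(5, |v - v'|+1)$ be primes, and let $\lambda_1 \in \mathbb F_{p_1}, \ldots, \lambda_k \in \mathbb F_{p_k}$ be such that $\lambda_i \neq \lambda_{j}$ whenever $p_i = p_j$ and $i \neq j$. Let \[ S= \{(T(\lambda_1-v), \ldots, T(\lambda_k-v)), (T(\lambda_1-v'), \ldots, T(\lambda_k-v'))\} \subset \operatorname{PSL}_2(p_1) \times \cdots \times \operatorname{PSL}_2(p_k), \] where $T(\mu)$ is the image in $\operatorname{PSL}_2(p)$ of $\begin{pmatrix} \mu & -1 \\ 1 & 0\end{pmatrix}$ for $\mu\in\mathbb F_p$. Then $\langle S^3S^{ -3}\rangle = \langle S^{ -3}S^{3}\rangle= \operatorname{PSL}_2(p_1) \times \cdots \times \operatorname{PSL}_2(p_k)$.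
   Context: $S^3S^{ -3}$ denotes the set of products $g_1g_2g_3g_4^{ -1}g_5^{ -1}g_6^{ -1}$ with $g_i\in S$, and $S^{ -3}S^3$ the set of products $g_1^{ -1}g_2^{ -1}g_3^{ -1}g_4g_5g_6$ with $g_i \in S$; $\langle X\rangle$ is the subgroup generated by $X$. -}

module Defs where

open import Data.Nat using (ℕ)
open import Data.Integer using (ℤ; +_; _+_; _-_; _*_; -_)
open import Data.Integer.Divisibility using (_∣_)
open import Data.Fin using (Fin)
open import Data.Bool using (Bool; true; false)
open import Data.Product using (_×_; Σ)
open import Data.Sum using (_⊎_)
open import Relation.Binary.PropositionalEquality using (_≡_)

-- Congruence of integers modulo a natural number p (equality in 𝔽_p
-- when p is prime, integers serving as representatives).
_≡_[mod_] : ℤ → ℤ → ℕ → Set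
a ≡ b [mod p ] = (+ p) ∣ (a - b)

record M₂ : Set where
  constructor mat
  field
    a b c d : ℤ
open M₂ public

_·_ : M₂ → M₂ → M₂
mat a₁ b₁ c₁ d₁ · mat a₂ b₂ c₂ d₂ =
  mat (a₁ * a₂ + b₁ * c₂) (a₁ * b₂ + b₁ * d₂)
      (c₁ * a₂ + d₁ * c₂) (c₁ * b₂ + d₁ * d₂)

I₂ : M₂
I₂ = mat (+ 1) (+ 0) (+ 0) (+ 1)

neg : M₂ → M₂
neg (mat x y z w) = mat (- x) (- y) (- z) (- w)

-- adjugate = inverse for determinant-1 matrices
adj : M₂ → M₂
adj (mat x y z w) = mat w (- y) (- z) x

det : M₂ → ℤ
det (mat x y z w) = x * w - y * z

_≡M_[mod_] : M₂ → M₂ → ℕ → Set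
A ≡M B [mod p ] =
  (a A ≡ a B [mod p ]) × (b A ≡ b B [mod p ]) ×
  (c A ≡ c B [mod p ]) × (d A ≡ d B [mod p ])

-- equality in PSL₂(p): A ≡ ±B mod p
_≈P_[mod_] : M₂ → M₂ → ℕ → Set
A ≈P B [mod p ] = (A ≡M B [mod p ]) ⊎ (A ≡M neg B [mod p ])

T : ℤ → M₂
T μ = mat μ (- (+ 1)) (+ 1) (+ 0)

-- The product PSL₂(p₁) × ⋯ × PSL₂(p_k), for p : Fin k → ℕ.
-- Elements are represented by tuples of integer matrices.
Tuple : ℕ → Set
Tuple k = Fin k → M₂

InProduct : {k : ℕ} → (Fin k → ℕ) → Tuple k → Set
InProduct p g = ∀ i → det (g i) ≡ + 1 [mod p i ]

_≈_[in_] : {k : ℕ} → Tuple k → Tuple k → (Fin k → ℕ) → Set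
g ≈ h [in p ] = ∀ i → g i ≈P h i [mod p i ]

_⊙_ : {k : ℕ} → Tuple k → Tuple k → Tuple k
(g ⊙ h) i = g i · h i

one : {k : ℕ} → Tuple k
one _ = I₂

inv : {k : ℕ} → Tuple k → Tuple k
inv g i = adj (g i)

data Gen {k : ℕ} (p : Fin k → ℕ) (X : Tuple k → Set) : Tuple k → Set where
  gen  : ∀ {g} → X g → Gen p X g
  gone : Gen p X one
  gmul : ∀ {g h} → Gen p X g → Gen p X h → Gen p X (g ⊙ h)
  ginv : ∀ {g} → Gen p X g → Gen p X (inv g)
  gresp : ∀ {g h} → g ≈ h [in p ] → Gen p X g → Gen p X h

-- The two-element set S = {s false, s true}, given as an indexing Bool → Tuple k
-- S³S⁻³ = { g₁g₂g₃g₄⁻¹g₅⁻¹g₆⁻¹ }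
S3S-3 : {k : ℕ} → (Fin k → ℕ) → (Bool → Tuple k) → Tuple k → Set
S3S-3 p s x = Σ Bool λ b₁ → Σ Bool λ b₂ → Σ Bool λ b₃ →
              Σ Bool λ b₄ → Σ Bool λ b₅ → Σ Bool λ b₆ →
  x ≈ (s b₁ ⊙ (s b₂ ⊙ (s b₃ ⊙ (inv (s b₄) ⊙ (inv (s b₅) ⊙ inv (s b₆)))))) [in p ]

S-3S3 : {k : ℕ} → (Fin k → ℕ) → (Bool → Tuple k) → Tuple k → Set
S-3S3 p s x = Σ Bool λ b₁ → Σ Bool λ b₂ → Σ Bool λ b₃ →
              Σ Bool λ b₄ → Σ Bool λ b₅ → Σ Bool λ b₆ →
  x ≈ (inv (s b₁) ⊙ (inv (s b₂) ⊙ (inv (s b₃) ⊙ (s b₄ ⊙ (s b₅ ⊙ s b₆))))) [in p ]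

Sgen : {k : ℕ} → (Fin k → ℤ) → ℤ → ℤ → Bool → Tuple k
Sgen lam v v' false i = T (lam i - v)
Sgen lam v v' true  i = T (lam i - v')

module Submission where

-- Write s, s′ for the two generators at one component, μ = λ − v and e = v′ − v, so that
-- 0 < |e| < p. The words s s′⁻¹, s (s s′⁻¹) s⁻¹ and s² (s s′⁻¹) s⁻² of S³S⁻³ are the
-- transvections with parameter e along (1, 0), (μ, 1) and (μ² − 1, μ). From powers and
-- conjugates of them we build, for indices j ≠ k, elements of ⟨S³S⁻³⟩ that are trivial at j and
-- realise every U(s) and L(s) at k: if p_j ≠ p_k a p_j-th power of the first word does; if
-- p_j = p_k then λ_j ≢ λ_k, and a quotient of two transvections whose fixed lines coincide only
-- at j is trivial at j and upper triangular with diagonal (4, 1/4) at k, so its commutator with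
-- the first word (or, for p = 5, its square) is a nontrivial unipotent at k. Commutators with
-- diag(2, 1/2) make such elements trivial at every j ≠ k at once, products U L U give all of
-- SL₂(p_k) at k, and multiplying over k gives the whole product. Finally A ↦ D Aᵀ D with
-- D = diag(1, −1) is an anti-automorphism fixing every T(μ); it reverses words and so carries
-- ⟨S³S⁻³⟩ onto ⟨S⁻³S³⟩.

open import Defs
open import Data.Nat using (ℕ; _≤_; _⊔_)
open import Data.Nat.Primality using (Prime)
open import Data.Integer using (ℤ; ∣_∣; _-_; +_)
open import Data.Fin using (Fin) renaming (_≤_ to _≤ᶠ_)
open import Data.Product using (_×_)
open import Relation.Binary.PropositionalEquality using (_≡_; _≢_)
open import Relation.Nullary using (¬_)

open import Agda.Builtin.FromNat using (Number; fromNat)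
open import Data.Unit using (tt)
import Data.Nat as ℕ
import Data.Nat.Literals as ℕ
import Data.Nat.Properties as ℕ
import Data.Nat.Divisibility as ℕ
open import Data.Nat.Primality using (prime⇒irreducible; prime⇒nonTrivial; euclidsLemma)
open import Data.Nat.Coprimality using (Coprime; coprime-Bézout)
open import Data.Nat.GCD using (module Bézout)
open import Data.Integer using (_+_; _*_; -_; -[1+_])
import Data.Integer.Literals as ℤ
import Data.Integer.Properties as ℤ
open import Data.Integer.Divisibility.Signed as Signed using (divides)
open import Data.Integer.Tactic.RingSolver using (solve-∀)
open import Data.Bool using (Bool; true; false)
import Data.Fin.Properties as Fin
open import Data.Product using (Σ; _,_; proj₁; proj₂)
open import Data.Sum using (inj₁; inj₂)
open import Data.Empty using (⊥-elim)
open import Relation.Nullary using (Dec; yes; no)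
open import Relation.Binary.PropositionalEquality using (refl; sym; trans; cong; cong₂; subst; module ≡-Reasoning)
open import Relation.Binary.Bundles using (Setoid)
open import Relation.Binary.Structures using (IsEquivalence)
import Relation.Binary.Reasoning.Setoid as SetoidReasoning
open import Relation.Unary using (Pred; ∅; ｛_｝; _∪_; _⊆_; ∁; _∖_)
open import Level using (0ℓ)
open import Data.List using (List; []; _∷_; allFin)
open import Data.List.Membership.Propositional using (_∈_; _∉_)
open import Data.List.Membership.Propositional.Properties using (∈-allFin)
open import Data.List.Relation.Unary.Any using (here; there)
import Data.List.Relation.Unary.All as All
open import Data.List.Relation.Unary.AllPairs using ([]; _∷_)
open import Data.List.Relation.Unary.Unique.Propositional using (Unique)
open import Data.List.Relation.Unary.Unique.Propositional.Properties using (allFin⁺)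

instance
  ℕ-number : Number ℕ
  ℕ-number = ℕ.number
  ℤ-number : Number ℤ
  ℤ-number = ℤ.number

mat-cong : ∀ {a₁ b₁ c₁ d₁ a₂ b₂ c₂ d₂ : ℤ} → a₁ ≡ a₂ → b₁ ≡ b₂ → c₁ ≡ c₂ → d₁ ≡ d₂ →
           mat a₁ b₁ c₁ d₁ ≡ mat a₂ b₂ c₂ d₂
mat-cong refl refl refl refl = refl

·-assoc : ∀ A B C → (A · B) · C ≡ A · (B · C)
·-assoc (mat a₁ b₁ c₁ d₁) (mat a₂ b₂ c₂ d₂) (mat a₃ b₃ c₃ d₃) = mat-cong
  (entry a₁ b₁ a₂ b₂ c₂ d₂ a₃ c₃) (entry a₁ b₁ a₂ b₂ c₂ d₂ b₃ d₃)
  (entry c₁ d₁ a₂ b₂ c₂ d₂ a₃ c₃) (entry c₁ d₁ a₂ b₂ c₂ d₂ b₃ d₃)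
  where
  entry : ∀ x y a b c d u w → (x * a + y * c) * u + (x * b + y * d) * w ≡ x * (a * u + b * w) + y * (c * u + d * w)
  entry = solve-∀

·-identityˡ : ∀ A → I₂ · A ≡ A
·-identityˡ (mat x y z w) = mat-cong (lemma x z) (lemma y w) (lemma′ x z) (lemma′ y w)
  where
  lemma : ∀ x z → 1 * x + 0 * z ≡ x
  lemma = solve-∀
  lemma′ : ∀ x z → 0 * x + 1 * z ≡ z
  lemma′ = solve-∀

·-identityʳ : ∀ A → A · I₂ ≡ A
·-identityʳ (mat x y z w) = mat-cong (lemma x y) (lemma′ x y) (lemma z w) (lemma′ z w)
  where
  lemma : ∀ x y → x * 1 + y * 0 ≡ x
  lemma = solve-∀
  lemma′ : ∀ x y → x * 0 + y * 1 ≡ y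
  lemma′ = solve-∀

det-· : ∀ A B → det (A · B) ≡ det A * det B
det-· (mat a₁ b₁ c₁ d₁) (mat a₂ b₂ c₂ d₂) = lemma a₁ b₁ c₁ d₁ a₂ b₂ c₂ d₂
  where
  lemma : ∀ a₁ b₁ c₁ d₁ a₂ b₂ c₂ d₂ →
    (a₁ * a₂ + b₁ * c₂) * (c₁ * b₂ + d₁ * d₂) - (a₁ * b₂ + b₁ * d₂) * (c₁ * a₂ + d₁ * c₂)
    ≡ (a₁ * d₁ - b₁ * c₁) * (a₂ * d₂ - b₂ * c₂)
  lemma = solve-∀

det-adj : ∀ A → det (adj A) ≡ det A
det-adj (mat x y z w) = lemma x y z w
  where
  lemma : ∀ x y z w → w * x - (- y) * (- z) ≡ x * w - y * z
  lemma = solve-∀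

adj-inverseʳ : ∀ A → det A ≡ 1 → A · adj A ≡ I₂
adj-inverseʳ (mat x y z w) det≡1 =
  mat-cong (trans (diagonal x y z w) det≡1) (off-diagonal x y) (off-diagonal′ z w)
           (trans (diagonal′ x y z w) det≡1)
  where
  diagonal : ∀ x y z w → x * w + y * (- z) ≡ x * w - y * z
  diagonal = solve-∀
  diagonal′ : ∀ x y z w → z * (- y) + w * x ≡ x * w - y * z
  diagonal′ = solve-∀
  off-diagonal : ∀ x y → x * (- y) + y * x ≡ 0
  off-diagonal = solve-∀
  off-diagonal′ : ∀ z w → z * w + w * (- z) ≡ 0
  off-diagonal′ = solve-∀

U L : ℤ → M₂
U x = mat 1 x 0 1
L x = mat 1 0 x 1

-- I + t (g, h)ᵀ (− h, g): the transvection fixing (g, h).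
transvection : ℤ → ℤ → ℤ → M₂
transvection g h t = mat (1 - t * g * h) (t * g * g) (- (t * h * h)) (1 + t * g * h)

det-transvection : ∀ g h t → det (transvection g h t) ≡ 1
det-transvection = lemma
  where
  lemma : ∀ g h t → (1 - t * g * h) * (1 + t * g * h) - (t * g * g) * (- (t * h * h)) ≡ 1
  lemma = solve-∀

transvection-+ : ∀ g h t s → transvection g h t · transvection g h s ≡ transvection g h (t + s)
transvection-+ g h t s = mat-cong (a-entry g h t s) (b-entry g h t s) (c-entry g h t s) (d-entry g h t s)
  where
  a-entry : ∀ g h t s → (1 - t * g * h) * (1 - s * g * h) + (t * g * g) * (- (s * h * h)) ≡ 1 - (t + s) * g * h
  a-entry = solve-∀
  b-entry : ∀ g h t s → (1 - t * g * h) * (s * g * g) + (t * g * g) * (1 + s * g * h) ≡ (t + s) * g * g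
  b-entry = solve-∀
  c-entry : ∀ g h t s → (- (t * h * h)) * (1 - s * g * h) + (1 + t * g * h) * (- (s * h * h)) ≡ - ((t + s) * h * h)
  c-entry = solve-∀
  d-entry : ∀ g h t s → (- (t * h * h)) * (s * g * g) + (1 + t * g * h) * (1 + s * g * h) ≡ 1 + (t + s) * g * h
  d-entry = solve-∀

transvection-zero : ∀ g h → transvection g h 0 ≡ I₂
transvection-zero g h = mat-cong (diagonal g h) (off-diagonal g) (cong -_ (off-diagonal h)) (diagonal′ g h)
  where
  diagonal : ∀ g h → 1 - 0 * g * h ≡ 1
  diagonal = solve-∀
  diagonal′ : ∀ g h → 1 + 0 * g * h ≡ 1
  diagonal′ = solve-∀
  off-diagonal : ∀ g → 0 * g * g ≡ 0
  off-diagonal = solve-∀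

adj-transvection : ∀ g h t → adj (transvection g h t) ≡ transvection g h (- t)
adj-transvection g h t = mat-cong (a-entry g h t) (b-entry g h t) (c-entry g h t) (d-entry g h t)
  where
  a-entry : ∀ g h t → 1 + t * g * h ≡ 1 - (- t) * g * h
  a-entry = solve-∀
  b-entry : ∀ g h t → - (t * g * g) ≡ (- t) * g * g
  b-entry = solve-∀
  c-entry : ∀ g h t → - (- (t * h * h)) ≡ - ((- t) * h * h)
  c-entry = solve-∀
  d-entry : ∀ g h t → 1 - t * g * h ≡ 1 + (- t) * g * h
  d-entry = solve-∀

transvection-scale : ∀ κ g h t → transvection (κ * g) (κ * h) t ≡ transvection g h (κ * κ * t)
transvection-scale κ g h t = mat-cong (a-entry κ g h t) (b-entry κ g h t) (c-entry κ g h t) (d-entry κ g h t)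
  where
  a-entry : ∀ κ g h t → 1 - t * (κ * g) * (κ * h) ≡ 1 - κ * κ * t * g * h
  a-entry = solve-∀
  b-entry : ∀ κ g h t → t * (κ * g) * (κ * g) ≡ κ * κ * t * g * g
  b-entry = solve-∀
  c-entry : ∀ κ g h t → - (t * (κ * h) * (κ * h)) ≡ - (κ * κ * t * h * h)
  c-entry = solve-∀
  d-entry : ∀ κ g h t → 1 + t * (κ * g) * (κ * h) ≡ 1 + κ * κ * t * g * h
  d-entry = solve-∀

adj-conj-transvection : ∀ M g h t →
  M · (transvection g h t · adj M) ≡
  mat (det M - t * (a M * g + b M * h) * (c M * g + d M * h)) (t * (a M * g + b M * h) * (a M * g + b M * h))
      (- (t * (c M * g + d M * h) * (c M * g + d M * h))) (det M + t * (a M * g + b M * h) * (c M * g + d M * h))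
adj-conj-transvection (mat x y z w) g h t =
  mat-cong (a-entry x y z w g h t) (b-entry x y g h t) (c-entry z w g h t) (d-entry x y z w g h t)
  where
  a-entry : ∀ x y z w g h t →
    x * ((1 - t * g * h) * w + (t * g * g) * (- z)) + y * ((- (t * h * h)) * w + (1 + t * g * h) * (- z))
    ≡ (x * w - y * z) - t * (x * g + y * h) * (z * g + w * h)
  a-entry = solve-∀
  b-entry : ∀ x y g h t →
    x * ((1 - t * g * h) * (- y) + (t * g * g) * x) + y * ((- (t * h * h)) * (- y) + (1 + t * g * h) * x)
    ≡ t * (x * g + y * h) * (x * g + y * h)
  b-entry = solve-∀
  c-entry : ∀ z w g h t →
    z * ((1 - t * g * h) * w + (t * g * g) * (- z)) + w * ((- (t * h * h)) * w + (1 + t * g * h) * (- z))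
    ≡ - (t * (z * g + w * h) * (z * g + w * h))
  c-entry = solve-∀
  d-entry : ∀ x y z w g h t →
    z * ((1 - t * g * h) * (- y) + (t * g * g) * x) + w * ((- (t * h * h)) * (- y) + (1 + t * g * h) * x)
    ≡ (x * w - y * z) + t * (x * g + y * h) * (z * g + w * h)
  d-entry = solve-∀

conj-transvection : ∀ M g h t → det M ≡ 1 →
  M · (transvection g h t · adj M) ≡ transvection (a M * g + b M * h) (c M * g + d M * h) t
conj-transvection M g h t det≡1 =
  trans (adj-conj-transvection M g h t) (cong (λ δ → mat (δ - t * G * H) (t * G * G) (- (t * H * H)) (δ + t * G * H)) det≡1)
  where
  G H : ℤ
  G = a M * g + b M * h
  H = c M * g + d M * h

transvection-1-0 : ∀ x → transvection 1 0 x ≡ U x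
transvection-1-0 x = mat-cong (a-entry x) (b-entry x) (c-entry x) (d-entry x)
  where
  a-entry : ∀ x → 1 - x * 1 * 0 ≡ 1
  a-entry = solve-∀
  b-entry : ∀ x → x * 1 * 1 ≡ x
  b-entry = solve-∀
  c-entry : ∀ x → - (x * 0 * 0) ≡ 0
  c-entry = solve-∀
  d-entry : ∀ x → 1 + x * 1 * 0 ≡ 1
  d-entry = solve-∀

transvection-0-1 : ∀ x → transvection 0 1 (- x) ≡ L x
transvection-0-1 x = mat-cong (a-entry x) (b-entry x) (c-entry x) (d-entry x)
  where
  a-entry : ∀ x → 1 - (- x) * 0 * 1 ≡ 1
  a-entry = solve-∀
  b-entry : ∀ x → (- x) * 0 * 0 ≡ 0
  b-entry = solve-∀
  c-entry : ∀ x → - ((- x) * 1 * 1) ≡ x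
  c-entry = solve-∀
  d-entry : ∀ x → 1 + (- x) * 0 * 1 ≡ 1
  d-entry = solve-∀

det-T : ∀ μ → det (T μ) ≡ 1
det-T = lemma
  where
  lemma : ∀ μ → μ * 0 - (- 1) * 1 ≡ 1
  lemma = solve-∀

adj-cancelˡ : ∀ B W → det B ≡ 1 → B · (adj B · W) ≡ W
adj-cancelˡ B W det≡1 = begin
  B · (adj B · W)  ≡⟨ ·-assoc B (adj B) W ⟨
  (B · adj B) · W  ≡⟨ cong (_· W) (adj-inverseʳ B det≡1) ⟩
  I₂ · W           ≡⟨ ·-identityˡ W ⟩
  W                ∎
  where open ≡-Reasoning

T-·-adj-T : ∀ x y → T x · adj (T y) ≡ U (x - y)
T-·-adj-T x y = mat-cong (a-entry x) (b-entry x y) refl (d-entry y)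
  where
  a-entry : ∀ x → x * 0 + (- 1) * (- 1) ≡ 1
  a-entry = solve-∀
  b-entry : ∀ x y → x * (- (- 1)) + (- 1) * y ≡ x - y
  b-entry = solve-∀
  d-entry : ∀ y → 1 * (- (- 1)) + 0 * y ≡ 1
  d-entry = solve-∀

conj-T : ∀ x g h t → T x · (transvection g h t · adj (T x)) ≡ transvection (x * g - h) g t
conj-T x g h t = trans (conj-transvection (T x) g h t (det-T x)) (cong₂ (λ G H → transvection G H t) (first x g h) (second g h))
  where
  first : ∀ x g h → x * g + (- 1) * h ≡ x * g - h
  first = solve-∀
  second : ∀ g h → 1 * g + 0 * h ≡ g
  second = solve-∀

word-c₀ : ∀ x y → T x · (T y · (T y · (adj (T y) · (adj (T y) · adj (T y))))) ≡ U (x - y)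
word-c₀ x y = begin
  T x · (T y · (T y · (adj (T y) · (adj (T y) · adj (T y)))))
    ≡⟨ cong (λ W → T x · (T y · W)) (adj-cancelˡ (T y) (adj (T y) · adj (T y)) (det-T y)) ⟩
  T x · (T y · (adj (T y) · adj (T y)))
    ≡⟨ cong (T x ·_) (adj-cancelˡ (T y) (adj (T y)) (det-T y)) ⟩
  T x · adj (T y)
    ≡⟨ T-·-adj-T x y ⟩
  U (x - y) ∎
  where open ≡-Reasoning

conj-T-U : ∀ x t → T x · (U t · adj (T x)) ≡ transvection x 1 t
conj-T-U x t = begin
  T x · (U t · adj (T x))                  ≡⟨ cong (λ V → T x · (V · adj (T x))) (transvection-1-0 t) ⟨
  T x · (transvection 1 0 t · adj (T x))  ≡⟨ conj-T x 1 0 t ⟩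
  transvection (x * 1 - 0) 1 t            ≡⟨ cong (λ G → transvection G 1 t) (simplify x) ⟩
  transvection x 1 t                      ∎
  where
  open ≡-Reasoning
  simplify : ∀ x → x * 1 - 0 ≡ x
  simplify = solve-∀

word-c₁ : ∀ x y → T x · (T x · (T y · (adj (T y) · (adj (T y) · adj (T x))))) ≡ transvection x 1 (x - y)
word-c₁ x y = begin
  T x · (T x · (T y · (adj (T y) · (adj (T y) · adj (T x)))))
    ≡⟨ cong (λ W → T x · (T x · W)) (adj-cancelˡ (T y) (adj (T y) · adj (T x)) (det-T y)) ⟩
  T x · (T x · (adj (T y) · adj (T x)))
    ≡⟨ cong (T x ·_) (·-assoc (T x) (adj (T y)) (adj (T x))) ⟨
  T x · ((T x · adj (T y)) · adj (T x))
    ≡⟨ cong (λ V → T x · (V · adj (T x))) (T-·-adj-T x y) ⟩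
  T x · (U (x - y) · adj (T x))
    ≡⟨ conj-T-U x (x - y) ⟩
  transvection x 1 (x - y) ∎
  where open ≡-Reasoning

word-c₂ : ∀ x y → T x · (T x · (T x · (adj (T y) · (adj (T x) · adj (T x))))) ≡ transvection (x * x - 1) x (x - y)
word-c₂ x y = begin
  T x · (T x · (T x · (adj (T y) · (adj (T x) · adj (T x)))))
    ≡⟨ cong (λ W → T x · (T x · W)) (·-assoc (T x) (adj (T y)) (adj (T x) · adj (T x))) ⟨
  T x · (T x · ((T x · adj (T y)) · (adj (T x) · adj (T x))))
    ≡⟨ cong (λ W → T x · (T x · W)) (·-assoc (T x · adj (T y)) (adj (T x)) (adj (T x))) ⟨
  T x · (T x · (((T x · adj (T y)) · adj (T x)) · adj (T x)))
    ≡⟨ cong (T x ·_) (·-assoc (T x) ((T x · adj (T y)) · adj (T x)) (adj (T x))) ⟨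
  T x · ((T x · ((T x · adj (T y)) · adj (T x))) · adj (T x))
    ≡⟨ cong (λ V → T x · ((T x · (V · adj (T x))) · adj (T x))) (T-·-adj-T x y) ⟩
  T x · ((T x · (U (x - y) · adj (T x))) · adj (T x))
    ≡⟨ cong (λ V → T x · (V · adj (T x))) (conj-T-U x (x - y)) ⟩
  T x · (transvection x 1 (x - y) · adj (T x))
    ≡⟨ conj-T x x 1 (x - y) ⟩
  transvection (x * x - 1) x (x - y) ∎
  where open ≡-Reasoning

upper-commutator-U : ∀ α β γ t →
  mat α β 0 γ · (U t · (adj (mat α β 0 γ) · adj (U t))) ≡ mat (α * γ) (α * α * t - α * γ * t) 0 (α * γ)
upper-commutator-U α β γ t = mat-cong (a-entry α β γ t) (b-entry α β γ t) (c-entry α β γ t) (d-entry α β γ t)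
  where
  a-entry : ∀ α β γ t →
    α * (1 * (γ * 1 + (- β) * (- 0)) + t * ((- 0) * 1 + α * (- 0))) + β * (0 * (γ * 1 + (- β) * (- 0)) + 1 * ((- 0) * 1 + α * (- 0)))
    ≡ α * γ
  a-entry = solve-∀
  b-entry : ∀ α β γ t →
    α * (1 * (γ * (- t) + (- β) * 1) + t * ((- 0) * (- t) + α * 1)) + β * (0 * (γ * (- t) + (- β) * 1) + 1 * ((- 0) * (- t) + α * 1))
    ≡ α * α * t - α * γ * t
  b-entry = solve-∀
  c-entry : ∀ α β γ t →
    0 * (1 * (γ * 1 + (- β) * (- 0)) + t * ((- 0) * 1 + α * (- 0))) + γ * (0 * (γ * 1 + (- β) * (- 0)) + 1 * ((- 0) * 1 + α * (- 0)))
    ≡ 0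
  c-entry = solve-∀
  d-entry : ∀ α β γ t →
    0 * (1 * (γ * (- t) + (- β) * 1) + t * ((- 0) * (- t) + α * 1)) + γ * (0 * (γ * (- t) + (- β) * 1) + 1 * ((- 0) * (- t) + α * 1))
    ≡ α * γ
  d-entry = solve-∀

U-L-U : ∀ x γ y → (U x · L γ) · U y ≡ mat (1 + x * γ) ((1 + x * γ) * y + x) γ (γ * y + 1)
U-L-U x γ y = mat-cong (a-entry x γ) (b-entry x γ y) (c-entry γ) (d-entry γ y)
  where
  a-entry : ∀ x γ → (1 * 1 + x * γ) * 1 + (1 * 0 + x * 1) * 0 ≡ 1 + x * γ
  a-entry = solve-∀
  b-entry : ∀ x γ y → (1 * 1 + x * γ) * y + (1 * 0 + x * 1) * 1 ≡ (1 + x * γ) * y + x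
  b-entry = solve-∀
  c-entry : ∀ γ → (0 * 1 + 1 * γ) * 1 + (0 * 0 + 1 * 1) * 0 ≡ γ
  c-entry = solve-∀
  d-entry : ∀ γ y → (0 * 1 + 1 * γ) * y + (0 * 0 + 1 * 1) * 1 ≡ γ * y + 1
  d-entry = solve-∀

L-cancel : ∀ M → L (- 1) · (L 1 · M) ≡ M
L-cancel M = trans (sym (·-assoc (L (- 1)) (L 1) M)) (·-identityˡ M)

det-U : ∀ x → det (U x) ≡ 1
det-U = lemma
  where
  lemma : ∀ x → 1 * 1 - x * 0 ≡ 1
  lemma = solve-∀

conj-U : ∀ x g h t → U x · (transvection g h t · adj (U x)) ≡ transvection (g + x * h) h t
conj-U x g h t = trans (conj-transvection (U x) g h t (det-U x)) (cong₂ (λ G H → transvection G H t) (first x g h) (second g h))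
  where
  first : ∀ x g h → 1 * g + x * h ≡ g + x * h
  first = solve-∀
  second : ∀ g h → 0 * g + 1 * h ≡ h
  second = solve-∀

infix 4 _≈_[mod_] _≅_[mod_]

record _≈_[mod_] (x y : ℤ) (q : ℕ) : Set where
  constructor by-divisibility
  field divisibility : + q Signed.∣ x - y

record _≅_[mod_] (A B : M₂) (q : ℕ) : Set where
  constructor entrywise
  field
    a≈ : a A ≈ a B [mod q ]
    b≈ : b A ≈ b B [mod q ]
    c≈ : c A ≈ c B [mod q ]
    d≈ : d A ≈ d B [mod q ]

open _≅_[mod_]

module Congruence (q : ℕ) where

  infix 4 _≈_ _≉_ _≅_

  _≈_ _≉_ : ℤ → ℤ → Set
  x ≈ y = x ≈ y [mod q ]
  x ≉ y = ¬ (x ≈ y)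

  _≅_ : M₂ → M₂ → Set
  A ≅ B = A ≅ B [mod q ]

  ≈-by-relation : ∀ {x y r} c → x - y ≡ c * r → r ≈ 0 → x ≈ y
  ≈-by-relation c eq (by-divisibility q∣r) =
    by-divisibility (subst (+ q Signed.∣_) (sym eq) (Signed.∣n⇒∣m*n c (subst (+ q Signed.∣_) (ℤ.+-identityʳ _) q∣r)))

  ≈-by-relations : ∀ {x y r₁ r₂} c₁ c₂ → x - y ≡ c₁ * r₁ + c₂ * r₂ → r₁ ≈ 0 → r₂ ≈ 0 → x ≈ y
  ≈-by-relations c₁ c₂ eq (by-divisibility q∣r₁) (by-divisibility q∣r₂) =
    by-divisibility (subst (+ q Signed.∣_) (sym eq)
      (Signed.∣m∣n⇒∣m+n (Signed.∣n⇒∣m*n c₁ (subst (+ q Signed.∣_) (ℤ.+-identityʳ _) q∣r₁))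
                        (Signed.∣n⇒∣m*n c₂ (subst (+ q Signed.∣_) (ℤ.+-identityʳ _) q∣r₂))))

  ≡⇒≈ : ∀ {x y} → x ≡ y → x ≈ y
  ≡⇒≈ {x} refl = by-divisibility (divides 0 (ℤ.+-inverseʳ x))

  ≈-refl : ∀ {x} → x ≈ x
  ≈-refl = ≡⇒≈ refl

  difference≈0 : ∀ {x y} → x ≈ y → x - y ≈ 0
  difference≈0 (by-divisibility q∣x-y) = by-divisibility (subst (+ q Signed.∣_) (sym (ℤ.+-identityʳ _)) q∣x-y)

  ≈-sym : ∀ {x y} → x ≈ y → y ≈ x
  ≈-sym {x} {y} x≈y = ≈-by-relation (- 1) (lemma x y) (difference≈0 x≈y)
    where
    lemma : ∀ x y → y - x ≡ - 1 * (x - y)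
    lemma = solve-∀

  ≈-trans : ∀ {x y z} → x ≈ y → y ≈ z → x ≈ z
  ≈-trans {x} {y} {z} x≈y y≈z = ≈-by-relations 1 1 (lemma x y z) (difference≈0 x≈y) (difference≈0 y≈z)
    where
    lemma : ∀ x y z → x - z ≡ 1 * (x - y) + 1 * (y - z)
    lemma = solve-∀

  ≈-isEquivalence : IsEquivalence _≈_
  ≈-isEquivalence = record { refl = ≈-refl ; sym = ≈-sym ; trans = ≈-trans }

  ≈-setoid : Setoid _ _
  ≈-setoid = record { isEquivalence = ≈-isEquivalence }

  module ≈-Reasoning = SetoidReasoning ≈-setoid

  +-cong : ∀ {x y u v} → x ≈ y → u ≈ v → x + u ≈ y + v
  +-cong {x} {y} {u} {v} x≈y u≈v = ≈-by-relations 1 1 (lemma x y u v) (difference≈0 x≈y) (difference≈0 u≈v)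
    where
    lemma : ∀ x y u v → x + u - (y + v) ≡ 1 * (x - y) + 1 * (u - v)
    lemma = solve-∀

  neg-cong : ∀ {x y} → x ≈ y → - x ≈ - y
  neg-cong {x} {y} x≈y = ≈-by-relation (- 1) (lemma x y) (difference≈0 x≈y)
    where
    lemma : ∀ x y → - x - - y ≡ - 1 * (x - y)
    lemma = solve-∀

  sub-cong : ∀ {x y u v} → x ≈ y → u ≈ v → x - u ≈ y - v
  sub-cong x≈y u≈v = +-cong x≈y (neg-cong u≈v)

  *-cong : ∀ {x y u v} → x ≈ y → u ≈ v → x * u ≈ y * v
  *-cong {x} {y} {u} {v} x≈y u≈v = ≈-by-relations u y (lemma x y u v) (difference≈0 x≈y) (difference≈0 u≈v)
    where
    lemma : ∀ x y u v → x * u - y * v ≡ u * (x - y) + y * (u - v)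
    lemma = solve-∀

  multiple≈0 : ∀ y → + q * y ≈ 0
  multiple≈0 y = by-divisibility (divides y (trans (ℤ.+-identityʳ (+ q * y)) (ℤ.*-comm (+ q) y)))

  modulus≈0 : + q ≈ 0
  modulus≈0 = subst (_≈ 0) (ℤ.*-identityʳ (+ q)) (multiple≈0 1)

  ≈⇒≡[mod] : ∀ {x y} → x ≈ y → x ≡ y [mod q ]
  ≈⇒≡[mod] (by-divisibility q∣x-y) = Signed.∣⇒∣ᵤ q∣x-y

  ≡[mod]⇒≈ : ∀ {x y} → x ≡ y [mod q ] → x ≈ y
  ≡[mod]⇒≈ q∣x-y = by-divisibility (Signed.∣ᵤ⇒∣ q∣x-y)

  ≈0⇒∣ : ∀ {x} → x ≈ 0 → q ℕ.∣ ∣ x ∣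
  ≈0⇒∣ {x} (by-divisibility q∣x-0) = subst (λ z → q ℕ.∣ ∣ z ∣) (ℤ.+-identityʳ x) (Signed.∣⇒∣ᵤ q∣x-0)

  ∣⇒≈0 : ∀ {x} → q ℕ.∣ ∣ x ∣ → x ≈ 0
  ∣⇒≈0 {x} q∣x = by-divisibility (Signed.∣ᵤ⇒∣ (subst (λ z → q ℕ.∣ ∣ z ∣) (sym (ℤ.+-identityʳ x)) q∣x))

  ≈0? : ∀ x → Dec (x ≈ 0)
  ≈0? x with q ℕ.∣? ∣ x ∣
  ... | yes q∣x = yes (∣⇒≈0 q∣x)
  ... | no q∤x = no (λ x≈0 → q∤x (≈0⇒∣ x≈0))

  ≉0-below : ∀ {x} → x ≢ 0 → ∣ x ∣ ℕ.< q → x ≉ 0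
  ≉0-below {x} x≢0 ∣x∣<q x≈0 with ∣ x ∣ in ∣x∣≡
  ... | 0 = x≢0 (ℤ.∣i∣≡0⇒i≡0 ∣x∣≡)
  ... | ℕ.suc m = ℕ.<⇒≱ ∣x∣<q (ℕ.∣⇒≤ (subst (q ℕ.∣_) ∣x∣≡ (≈0⇒∣ x≈0)))

  ≡⇒≅ : ∀ {A B} → A ≡ B → A ≅ B
  ≡⇒≅ refl = entrywise ≈-refl ≈-refl ≈-refl ≈-refl

  ≅-refl : ∀ {A} → A ≅ A
  ≅-refl = ≡⇒≅ refl

  ≅-sym : ∀ {A B} → A ≅ B → B ≅ A
  ≅-sym (entrywise a≈ b≈ c≈ d≈) = entrywise (≈-sym a≈) (≈-sym b≈) (≈-sym c≈) (≈-sym d≈)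

  ≅-trans : ∀ {A B C} → A ≅ B → B ≅ C → A ≅ C
  ≅-trans (entrywise a≈ b≈ c≈ d≈) (entrywise a≈′ b≈′ c≈′ d≈′) =
    entrywise (≈-trans a≈ a≈′) (≈-trans b≈ b≈′) (≈-trans c≈ c≈′) (≈-trans d≈ d≈′)

  ≅-isEquivalence : IsEquivalence _≅_
  ≅-isEquivalence = record { refl = ≅-refl ; sym = ≅-sym ; trans = ≅-trans }

  ≅-setoid : Setoid _ _
  ≅-setoid = record { isEquivalence = ≅-isEquivalence }

  module ≅-Reasoning = SetoidReasoning ≅-setoid

  ·-cong : ∀ {A B C D} → A ≅ B → C ≅ D → A · C ≅ B · D
  ·-cong {mat _ _ _ _} {mat _ _ _ _} {mat _ _ _ _} {mat _ _ _ _} (entrywise a≈ b≈ c≈ d≈) (entrywise a≈′ b≈′ c≈′ d≈′) =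
    entrywise (+-cong (*-cong a≈ a≈′) (*-cong b≈ c≈′)) (+-cong (*-cong a≈ b≈′) (*-cong b≈ d≈′))
              (+-cong (*-cong c≈ a≈′) (*-cong d≈ c≈′)) (+-cong (*-cong c≈ b≈′) (*-cong d≈ d≈′))

  adj-cong : ∀ {A B} → A ≅ B → adj A ≅ adj B
  adj-cong {mat _ _ _ _} {mat _ _ _ _} (entrywise a≈ b≈ c≈ d≈) = entrywise d≈ (neg-cong b≈) (neg-cong c≈) a≈

  conj-cong : ∀ {M N A B} → M ≅ N → A ≅ B → M · (A · adj M) ≅ N · (B · adj N)
  conj-cong M≅N A≅B = ·-cong M≅N (·-cong A≅B (adj-cong M≅N))

  transvection-cong : ∀ {g g′ h h′ t t′} → g ≈ g′ → h ≈ h′ → t ≈ t′ → transvection g h t ≅ transvection g′ h′ t′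
  transvection-cong g≈ h≈ t≈ = entrywise
    (sub-cong (≈-refl {1}) (*-cong (*-cong t≈ g≈) h≈)) (*-cong (*-cong t≈ g≈) g≈)
    (neg-cong (*-cong (*-cong t≈ h≈) h≈)) (+-cong (≈-refl {1}) (*-cong (*-cong t≈ g≈) h≈))

  U-cong : ∀ {x y} → x ≈ y → U x ≅ U y
  U-cong x≈y = entrywise ≈-refl x≈y ≈-refl ≈-refl

  triangular : ∀ {M α} → a M ≈ α → c M ≈ 0 → det M ≈ 1 → M ≅ mat α (b M) 0 (d M) × α * d M ≈ 1
  triangular {M} {α} a≈α c≈0 det≈1 = entrywise a≈α ≈-refl c≈0 ≈-refl , (begin
    α * d M              ≡⟨ lemma α (b M) (d M) ⟨
    α * d M - b M * 0    ≈⟨ sub-cong (*-cong a≈α ≈-refl) (*-cong (≈-refl {b M}) c≈0) ⟨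
    det M                ≈⟨ det≈1 ⟩
    1                    ∎)
    where
    open ≈-Reasoning
    lemma : ∀ α β δ → α * δ - β * 0 ≡ α * δ
    lemma = solve-∀

  ≅⇒≡M[mod] : ∀ {A B} → A ≅ B → A ≡M B [mod q ]
  ≅⇒≡M[mod] (entrywise a≈ b≈ c≈ d≈) = ≈⇒≡[mod] a≈ , ≈⇒≡[mod] b≈ , ≈⇒≡[mod] c≈ , ≈⇒≡[mod] d≈

  ≡M[mod]⇒≅ : ∀ {A B} → A ≡M B [mod q ] → A ≅ B
  ≡M[mod]⇒≅ (a≡ , b≡ , c≡ , d≡) = entrywise (≡[mod]⇒≈ a≡) (≡[mod]⇒≈ b≡) (≡[mod]⇒≈ c≡) (≡[mod]⇒≈ d≡)

module PrimeField {q : ℕ} (prime : Prime q) where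
  open Congruence q

  1≉0 : 1 ≉ 0
  1≉0 = ≉0-below (λ ()) (ℕ.nonTrivial⇒n>1 q {{prime⇒nonTrivial prime}})

  *-≉0 : ∀ {x y} → x ≉ 0 → y ≉ 0 → x * y ≉ 0
  *-≉0 {x} {y} x≉0 y≉0 xy≈0 with euclidsLemma ∣ x ∣ ∣ y ∣ prime (subst (q ℕ.∣_) (ℤ.abs-* x y) (≈0⇒∣ xy≈0))
  ... | inj₁ q∣x = x≉0 (∣⇒≈0 q∣x)
  ... | inj₂ q∣y = y≉0 (∣⇒≈0 q∣y)

  *-cancelˡ : ∀ {k x y} → k ≉ 0 → k * x ≈ k * y → x ≈ y
  *-cancelˡ {k} {x} {y} k≉0 kx≈ky with ≈0? (x - y)
  ... | yes x-y≈0 = ≈-by-relation 1 (lemma x y) x-y≈0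
    where
    lemma : ∀ x y → x - y ≡ 1 * (x - y)
    lemma = solve-∀
  ... | no x-y≉0 = ⊥-elim (*-≉0 k≉0 x-y≉0 (≈-by-relation 1 (lemma k x y) (difference≈0 kx≈ky)))
    where
    lemma : ∀ k x y → k * (x - y) - 0 ≡ 1 * (k * x - k * y)
    lemma = solve-∀

  private
    toℤ : ∀ a b c d → 1 ℕ.+ a ℕ.* b ≡ c ℕ.* d → 1 + + a * + b ≡ + c * + d
    toℤ a b c d eq =
      trans (sym (trans (ℤ.pos-+ 1 (a ℕ.* b)) (cong (λ z → 1 + z) (ℤ.pos-* a b)))) (trans (cong +_ eq) (ℤ.pos-* c d))

    inverse-ℕ : ∀ n → ¬ (q ℕ.∣ n) → Σ ℤ λ y → + n * y ≈ 1
    inverse-ℕ n q∤n with coprime-Bézout n⊥q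
      where
      n⊥q : Coprime n q
      n⊥q (d∣n , d∣q) with prime⇒irreducible prime d∣q
      ... | inj₁ d≡1 = d≡1
      ... | inj₂ refl = ⊥-elim (q∤n d∣n)
    ... | Bézout.+- x y 1+yq≡xn = + x , ≈-by-relation 1 (lemma (+ n) (+ x) (+ y) (+ q) (toℤ y q x n 1+yq≡xn)) (multiple≈0 (+ y))
      where
      lemma : ∀ n x y q → 1 + y * q ≡ x * n → n * x - 1 ≡ 1 * (q * y)
      lemma n x y q eq = trans (commute n x) (trans (cong (_- 1) (sym eq)) (cancel y q))
        where
        commute : ∀ n x → n * x - 1 ≡ x * n - 1
        commute = solve-∀
        cancel : ∀ y q → 1 + y * q - 1 ≡ 1 * (q * y)
        cancel = solve-∀
    ... | Bézout.-+ x y 1+xn≡yq = - + x , ≈-by-relation (- 1) (lemma (+ n) (+ x) (+ y) (+ q) (toℤ x n y q 1+xn≡yq)) (multiple≈0 (+ y))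
      where
      lemma : ∀ n x y q → 1 + x * n ≡ y * q → n * (- x) - 1 ≡ - 1 * (q * y)
      lemma n x y q eq = trans (expand n x) (trans (cong -_ eq) (commute y q))
        where
        expand : ∀ n x → n * (- x) - 1 ≡ - (1 + x * n)
        expand = solve-∀
        commute : ∀ y q → - (y * q) ≡ - 1 * (q * y)
        commute = solve-∀

  inverse : ∀ x → x ≉ 0 → Σ ℤ λ y → x * y ≈ 1
  inverse x x≉0 with inverse-ℕ ∣ x ∣ (λ q∣x → x≉0 (∣⇒≈0 q∣x)) | ℤ.+∣i∣≡i⊎+∣i∣≡-i x
  ... | y , ∣x∣y≈1 | inj₁ ∣x∣≡x = y , subst (λ z → z * y ≈ 1) ∣x∣≡x ∣x∣y≈1
  ... | y , ∣x∣y≈1 | inj₂ ∣x∣≡-x = - y , subst (_≈ 1) (lemma x y) (subst (λ z → z * y ≈ 1) ∣x∣≡-x ∣x∣y≈1)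
    where
    lemma : ∀ x y → (- x) * y ≡ x * (- y)
    lemma = solve-∀

module Subgroup {K : ℕ} (p : Fin K → ℕ) (X : Tuple K → Set) where

  Member : Tuple K → Set
  Member g = Gen p X g × (∀ i → det (g i) ≡ 1)

  member-one : Member one
  member-one = gone , λ _ → refl

  member-· : ∀ {g h} → Member g → Member h → Member (g ⊙ h)
  member-· {g} {h} (g∈ , det-g) (h∈ , det-h) =
    gmul g∈ h∈ , λ i → trans (det-· (g i) (h i)) (cong₂ _*_ (det-g i) (det-h i))

  member-inv : ∀ {g} → Member g → Member (inv g)
  member-inv {g} (g∈ , det-g) = ginv g∈ , λ i → trans (det-adj (g i)) (det-g i)

  pow : Tuple K → ℕ → Tuple K
  pow g ℕ.zero = one
  pow g (ℕ.suc n) = g ⊙ pow g n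

  zpow : Tuple K → ℤ → Tuple K
  zpow g (+ n) = pow g n
  zpow g -[1+ n ] = inv (pow g (ℕ.suc n))

  member-pow : ∀ {g} → Member g → ∀ n → Member (pow g n)
  member-pow g∈ ℕ.zero = member-one
  member-pow g∈ (ℕ.suc n) = member-· g∈ (member-pow g∈ n)

  member-zpow : ∀ {g} → Member g → ∀ z → Member (zpow g z)
  member-zpow g∈ (+ n) = member-pow g∈ n
  member-zpow g∈ -[1+ n ] = member-inv (member-pow g∈ (ℕ.suc n))

  conj : Tuple K → Tuple K → Tuple K
  conj h g = h ⊙ (g ⊙ inv h)

  commutator : Tuple K → Tuple K → Tuple K
  commutator g h = g ⊙ (h ⊙ (inv g ⊙ inv h))

  member-conj : ∀ {h g} → Member h → Member g → Member (conj h g)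
  member-conj h∈ g∈ = member-· h∈ (member-· g∈ (member-inv h∈))

  member-commutator : ∀ {g h} → Member g → Member h → Member (commutator g h)
  member-commutator g∈ h∈ = member-· g∈ (member-· h∈ (member-· (member-inv g∈) (member-inv h∈)))

  module _ (q : ℕ) (i : Fin K) where
    open Congruence q

    zpow-transvection : ∀ {g G H t} → g i ≅ transvection G H t → ∀ z → zpow g z i ≅ transvection G H (z * t)
    zpow-transvection {g} {G} {H} {t} gᵢ≅ (+ n) = pow-transvection n
      where
      pow-transvection : ∀ n → pow g n i ≅ transvection G H (+ n * t)
      pow-transvection ℕ.zero = ≡⇒≅ (sym (transvection-zero G H))
      pow-transvection (ℕ.suc n) = begin
        g i · pow g n i                                     ≈⟨ ·-cong gᵢ≅ (pow-transvection n) ⟩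
        transvection G H t · transvection G H (+ n * t)     ≡⟨ transvection-+ G H t (+ n * t) ⟩
        transvection G H (t + + n * t)                      ≡⟨ cong (transvection G H) (lemma n t) ⟩
        transvection G H (+ ℕ.suc n * t)                    ∎
        where
        open ≅-Reasoning
        lemma : ∀ n t → t + + n * t ≡ + ℕ.suc n * t
        lemma n t = trans (distrib (+ n) t) (cong (_* t) (sym (ℤ.pos-+ 1 n)))
          where
          distrib : ∀ m t → t + m * t ≡ (1 + m) * t
          distrib = solve-∀
    zpow-transvection {g} {G} {H} {t} gᵢ≅ -[1+ n ] = begin
      adj (pow g (ℕ.suc n) i)                          ≈⟨ adj-cong (zpow-transvection {g} {G} {H} {t} gᵢ≅ (+ ℕ.suc n)) ⟩
      adj (transvection G H (+ ℕ.suc n * t))          ≡⟨ adj-transvection G H (+ ℕ.suc n * t) ⟩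
      transvection G H (- (+ ℕ.suc n * t))            ≡⟨ cong (transvection G H) (ℤ.neg-distribˡ-* (+ ℕ.suc n) t) ⟩
      transvection G H (-[1+ n ] * t)                 ∎
      where open ≅-Reasoning

  Trivial : Fin K → Tuple K → Set
  Trivial j g = g j ≅ I₂ [mod p j ]

  module _ {j : Fin K} where
    open Congruence (p j)

    trivial-· : ∀ {g h} → Trivial j g → Trivial j h → Trivial j (g ⊙ h)
    trivial-· gⱼ≅I hⱼ≅I = ≅-trans (·-cong gⱼ≅I hⱼ≅I) (≡⇒≅ (·-identityˡ I₂))

    trivial-inv : ∀ {g} → Trivial j g → Trivial j (inv g)
    trivial-inv gⱼ≅I = adj-cong gⱼ≅I

    trivial-zpow : ∀ {g} → Trivial j g → ∀ z → Trivial j (zpow g z)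
    trivial-zpow {g} gⱼ≅I (+ n) = trivial-pow n
      where
      trivial-pow : ∀ n → Trivial j (pow g n)
      trivial-pow ℕ.zero = ≅-refl
      trivial-pow (ℕ.suc n) = trivial-· {g} {pow g n} gⱼ≅I (trivial-pow n)
    trivial-zpow {g} gⱼ≅I -[1+ n ] = trivial-inv {pow g (ℕ.suc n)} (trivial-zpow {g} gⱼ≅I (+ ℕ.suc n))

    trivial-conj : ∀ {h g} → Member h → Trivial j g → Trivial j (conj h g)
    trivial-conj {h} {g} (_ , det-h) gⱼ≅I = begin
      h j · (g j · adj (h j))   ≈⟨ ·-cong (≅-refl {h j}) (·-cong gⱼ≅I (≅-refl {adj (h j)})) ⟩
      h j · (I₂ · adj (h j))    ≡⟨ cong (h j ·_) (·-identityˡ (adj (h j))) ⟩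
      h j · adj (h j)           ≡⟨ adj-inverseʳ (h j) (det-h j) ⟩
      I₂                        ∎
      where open ≅-Reasoning

    trivial-commutatorˡ : ∀ {g h} → Member h → Trivial j g → Trivial j (commutator g h)
    trivial-commutatorˡ {g} {h} (_ , det-h) gⱼ≅I = begin
      g j · (h j · (adj (g j) · adj (h j)))
        ≈⟨ ·-cong gⱼ≅I (·-cong (≅-refl {h j}) (·-cong (adj-cong gⱼ≅I) (≅-refl {adj (h j)}))) ⟩
      I₂ · (h j · (I₂ · adj (h j)))
        ≡⟨ ·-identityˡ _ ⟩
      h j · (I₂ · adj (h j))
        ≡⟨ cong (h j ·_) (·-identityˡ (adj (h j))) ⟩
      h j · adj (h j)
        ≡⟨ adj-inverseʳ (h j) (det-h j) ⟩
      I₂ ∎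
      where open ≅-Reasoning

    trivial-commutatorʳ : ∀ {g h} → Member g → Trivial j h → Trivial j (commutator g h)
    trivial-commutatorʳ {g} {h} (_ , det-g) hⱼ≅I = begin
      g j · (h j · (adj (g j) · adj (h j)))
        ≈⟨ ·-cong (≅-refl {g j}) (·-cong hⱼ≅I (·-cong (≅-refl {adj (g j)}) (adj-cong hⱼ≅I))) ⟩
      g j · (I₂ · (adj (g j) · I₂))
        ≡⟨ cong (g j ·_) (trans (·-identityˡ _) (·-identityʳ (adj (g j)))) ⟩
      g j · adj (g j)
        ≡⟨ adj-inverseʳ (g j) (det-g j) ⟩
      I₂ ∎
      where open ≅-Reasoning

  record Realiser (S : Pred (Fin K) 0ℓ) (k : Fin K) (M : M₂) : Set where
    constructor realiser
    field
      element  : Tuple K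
      member   : Member element
      trivial  : ∀ j → S j → Trivial j element
      realises : element k ≅ M [mod p k ]

  AllU AllL : Pred (Fin K) 0ℓ → Fin K → Set
  AllU S k = ∀ s → Realiser S k (U s)
  AllL S k = ∀ s → Realiser S k (L s)

  module _ {k : Fin K} where
    open Congruence (p k)
    open Realiser

    realiser-resp : ∀ {S M N} → M ≅ N → Realiser S k M → Realiser S k N
    realiser-resp M≅N (realiser g g∈ triv gₖ≅M) = realiser g g∈ triv (≅-trans gₖ≅M M≅N)

    realiser-weaken : ∀ {S S′ M} → S′ ⊆ S → Realiser S k M → Realiser S′ k M
    realiser-weaken S′⊆S (realiser g g∈ triv gₖ≅M) = realiser g g∈ (λ j j∈S′ → triv j (S′⊆S j∈S′)) gₖ≅M

    realiser-· : ∀ {S M N} → Realiser S k M → Realiser S k N → Realiser S k (M · N)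
    realiser-· (realiser g g∈ triv-g gₖ≅M) (realiser h h∈ triv-h hₖ≅N) =
      realiser (g ⊙ h) (member-· g∈ h∈) (λ j j∈S → trivial-· {j} {g} {h} (triv-g j j∈S) (triv-h j j∈S))
               (·-cong gₖ≅M hₖ≅N)

    realiser-conj : ∀ {S h M} → Member h → Realiser S k M → Realiser S k (h k · (M · adj (h k)))
    realiser-conj {h = h} h∈ (realiser g g∈ triv gₖ≅M) =
      realiser (conj h g) (member-conj h∈ g∈) (λ j j∈S → trivial-conj {j} {h} {g} h∈ (triv j j∈S))
               (·-cong (≅-refl {h k}) (·-cong gₖ≅M (≅-refl {adj (h k)})))

    realiser-commutator : ∀ {S S′ M N} → Realiser S k M → Realiser S′ k N → Realiser (S ∪ S′) k (M · (N · (adj M · adj N)))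
    realiser-commutator {S} {S′} (realiser g g∈ triv-g gₖ≅M) (realiser h h∈ triv-h hₖ≅N) =
      realiser (commutator g h) (member-commutator g∈ h∈) trivial-on-union
               (·-cong gₖ≅M (·-cong hₖ≅N (·-cong (adj-cong gₖ≅M) (adj-cong hₖ≅N))))
      where
      trivial-on-union : ∀ j → (S ∪ S′) j → Trivial j (commutator g h)
      trivial-on-union j (inj₁ j∈S) = trivial-commutatorˡ {j} {g} {h} h∈ (triv-g j j∈S)
      trivial-on-union j (inj₂ j∈S′) = trivial-commutatorʳ {j} {g} {h} g∈ (triv-h j j∈S′)

    realiser-upper-commutator : ∀ {S S′ α β γ t} → α * γ ≈ 1 →
      Realiser S k (mat α β 0 γ) → Realiser S′ k (U t) → Realiser (S ∪ S′) k (U (α * α * t - t))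
    realiser-upper-commutator {α = α} {β} {γ} {t} αγ≈1 P R = realiser-resp commutator≅U (realiser-commutator P R)
      where
      lemma : ∀ α γ t → α * α * t - α * γ * t - (α * α * t - t) ≡ (- t) * (α * γ - 1)
      lemma = solve-∀
      commutator≅U : mat α β 0 γ · (U t · (adj (mat α β 0 γ) · adj (U t))) ≅ U (α * α * t - t)
      commutator≅U = ≅-trans (≡⇒≅ (upper-commutator-U α β γ t))
        (entrywise αγ≈1 (≈-by-relation (- t) (lemma α γ t) (difference≈0 αγ≈1)) ≈-refl αγ≈1)

  module _ {g : Tuple K} (realisers : ∀ k → Realiser (∁ ｛ k ｝) k (g k)) where
    open Realiser

    private
      Agrees : List (Fin K) → Tuple K → Set
      Agrees J h = (∀ i → i ∈ J → h i ≅ g i [mod p i ]) × (∀ i → i ∉ J → Trivial i h)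

      product-agrees : ∀ J → Unique J → Σ (Tuple K) λ h → Member h × Agrees J h
      product-agrees [] [] = one , member-one , (λ _ ()) , (λ i _ → Congruence.≅-refl (p i))
      product-agrees (k ∷ J) (k≢J ∷ unique-J) with product-agrees J unique-J
      ... | h , h∈ , on-J , off-J = element (realisers k) ⊙ h , member-· (member (realisers k)) h∈ , on , off
        where
        Rₖ = element (realisers k)
        on : ∀ i → i ∈ k ∷ J → Rₖ i · h i ≅ g i [mod p i ]
        on i (here refl) = ≅-trans (·-cong (realises (realisers i)) (off-J i (λ i∈J → All.lookup k≢J i∈J refl)))
                                   (≡⇒≅ (·-identityʳ (g i)))
          where open Congruence (p i)
        on i (there i∈J) = ≅-trans (·-cong (trivial (realisers k) i (All.lookup k≢J i∈J)) (on-J i i∈J))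
                                   (≡⇒≅ (·-identityˡ (g i)))
          where open Congruence (p i)
        off : ∀ i → i ∉ k ∷ J → Trivial i (Rₖ ⊙ h)
        off i i∉ = trivial-· {i} {Rₖ} {h} (trivial (realisers k) i (λ { refl → i∉ (here refl) }))
                                          (off-J i (λ i∈J → i∉ (there i∈J)))

    generated-by-realisers : Gen p X g
    generated-by-realisers with product-agrees (allFin K) (allFin⁺ K)
    ... | h , (h∈ , _) , on , _ = gresp (λ i → inj₁ (Congruence.≅⇒≡M[mod] (p i) (on i (∈-allFin i)))) h∈

  module _ {k : Fin K} (prime : Prime (p k)) where
    open Congruence (p k)
    open PrimeField prime

    AllU-from-one : ∀ {S x} → Realiser S k (U x) → x ≉ 0 → AllU S k
    AllU-from-one {S} {x} (realiser g g∈ triv gₖ≅U) x≉0 s =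
      realiser (zpow g z) (member-zpow g∈ z) (λ j j∈S → trivial-zpow {j} {g} (triv j j∈S) z) realises
      where
      y = proj₁ (inverse x x≉0)
      z = s * y
      gₖ≅transvection : g k ≅ transvection 1 0 x
      gₖ≅transvection = ≅-trans gₖ≅U (≡⇒≅ (sym (transvection-1-0 x)))
      lemma : ∀ s y x → s * y * x - s ≡ s * (x * y - 1)
      lemma = solve-∀
      realises : zpow g z k ≅ U s
      realises = begin
        zpow g z k                ≈⟨ zpow-transvection (p k) k {g} gₖ≅transvection z ⟩
        transvection 1 0 (z * x)  ≡⟨ transvection-1-0 (z * x) ⟩
        U (z * x)                 ≈⟨ U-cong (≈-by-relation s (lemma s y x) (difference≈0 (proj₂ (inverse x x≉0)))) ⟩
        U s                       ∎
        where open ≅-Reasoning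

    AllL-from-AllU : ∀ {S Q κ} → Member Q → a (Q k) ≈ 0 → c (Q k) ≈ κ → κ ≉ 0 → AllU S k → AllL S k
    AllL-from-AllU {S} {Q} {κ} Q∈ a≈0 c≈κ κ≉0 allU s = realiser-resp conjugate≅L (realiser-conj Q∈ (allU s′))
      where
      y = proj₁ (inverse κ κ≉0)
      s′ = - (s * y * y)
      first : ∀ α β κ → α * 1 + β * 0 - κ * 0 ≡ 1 * (α - 0)
      first = solve-∀
      second : ∀ γ δ κ → γ * 1 + δ * 0 - κ * 1 ≡ 1 * (γ - κ)
      second = solve-∀
      parameter : ∀ κ y s → κ * κ * (- (s * y * y)) - (- s) ≡ (- s) * (κ * y + 1) * (κ * y - 1)
      parameter = solve-∀
      Qe₁≈κe₂ : (a (Q k) * 1 + b (Q k) * 0 ≈ κ * 0) × (c (Q k) * 1 + d (Q k) * 0 ≈ κ * 1)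
      Qe₁≈κe₂ = ≈-by-relation 1 (first (a (Q k)) (b (Q k)) κ) (difference≈0 a≈0) ,
                ≈-by-relation 1 (second (c (Q k)) (d (Q k)) κ) (difference≈0 c≈κ)
      κκs′≈-s : κ * κ * s′ ≈ - s
      κκs′≈-s = ≈-by-relation ((- s) * (κ * y + 1)) (parameter κ y s) (difference≈0 (proj₂ (inverse κ κ≉0)))
      conjugate≅L : Q k · (U s′ · adj (Q k)) ≅ L s
      conjugate≅L = begin
        Q k · (U s′ · adj (Q k))
          ≡⟨ cong (λ V → Q k · (V · adj (Q k))) (transvection-1-0 s′) ⟨
        Q k · (transvection 1 0 s′ · adj (Q k))
          ≡⟨ conj-transvection (Q k) 1 0 s′ (proj₂ Q∈ k) ⟩
        transvection (a (Q k) * 1 + b (Q k) * 0) (c (Q k) * 1 + d (Q k) * 0) s′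
          ≈⟨ transvection-cong (proj₁ Qe₁≈κe₂) (proj₂ Qe₁≈κe₂) (≈-refl {s′}) ⟩
        transvection (κ * 0) (κ * 1) s′
          ≡⟨ transvection-scale κ 0 1 s′ ⟩
        transvection 0 1 (κ * κ * s′)
          ≈⟨ transvection-cong (≈-refl {0}) (≈-refl {1}) κκs′≈-s ⟩
        transvection 0 1 (- s)
          ≡⟨ transvection-0-1 s ⟩
        L s ∎
        where open ≅-Reasoning

    realiser-SL₂-c≉0 : ∀ {S} → AllU S k → AllL S k → ∀ M → det M ≈ 1 → c M ≉ 0 → Realiser S k M
    realiser-SL₂-c≉0 allU allL (mat α β γ δ) det≈1 γ≉0 =
      realiser-resp U-L-U≅M (realiser-· (realiser-· (allU x) (allL γ)) (allU y))
      where
      γ⁻¹ = proj₁ (inverse γ γ≉0)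
      γγ⁻¹-1≈0 : γ * γ⁻¹ - 1 ≈ 0
      γγ⁻¹-1≈0 = difference≈0 (proj₂ (inverse γ γ≉0))
      x = (α - 1) * γ⁻¹
      y = (δ - 1) * γ⁻¹
      a-entry : ∀ α γ γ⁻¹ → 1 + (α - 1) * γ⁻¹ * γ - α ≡ (α - 1) * (γ * γ⁻¹ - 1)
      a-entry = solve-∀
      b-entry : ∀ α β γ δ γ⁻¹ → (1 + (α - 1) * γ⁻¹ * γ) * ((δ - 1) * γ⁻¹) + (α - 1) * γ⁻¹ - β
                ≡ γ⁻¹ * (α * δ - β * γ - 1) + (β + (α - 1) * (δ - 1) * γ⁻¹) * (γ * γ⁻¹ - 1)
      b-entry = solve-∀
      d-entry : ∀ γ δ γ⁻¹ → γ * ((δ - 1) * γ⁻¹) + 1 - δ ≡ (δ - 1) * (γ * γ⁻¹ - 1)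
      d-entry = solve-∀
      U-L-U≅M : (U x · L γ) · U y ≅ mat α β γ δ
      U-L-U≅M = ≅-trans (≡⇒≅ (U-L-U x γ y))
        (entrywise (≈-by-relation (α - 1) (a-entry α γ γ⁻¹) γγ⁻¹-1≈0)
                   (≈-by-relations γ⁻¹ (β + (α - 1) * (δ - 1) * γ⁻¹) (b-entry α β γ δ γ⁻¹)
                                   (difference≈0 det≈1) γγ⁻¹-1≈0)
                   ≈-refl
                   (≈-by-relation (δ - 1) (d-entry γ δ γ⁻¹) γγ⁻¹-1≈0))

    realiser-SL₂ : ∀ {S} → AllU S k → AllL S k → ∀ M → det M ≈ 1 → Realiser S k M
    realiser-SL₂ allU allL M det≈1 with ≈0? (c M)
    ... | no c≉0 = realiser-SL₂-c≉0 allU allL M det≈1 c≉0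
    ... | yes c≈0 =
      realiser-resp (≡⇒≅ (L-cancel M)) (realiser-· (allL (- 1)) (realiser-SL₂-c≉0 allU allL (L 1 · M) det≈1′ c≉0′))
      where
      det≈1′ : det (L 1 · M) ≈ 1
      det≈1′ = ≈-trans (≡⇒≈ (trans (det-· (L 1) M) (ℤ.*-identityˡ (det M)))) det≈1
      lemma : ∀ α β γ δ → α * δ - β * γ - 0 ≡ δ * (1 * α + 1 * γ - 0) + (- (δ + β)) * (γ - 0)
      lemma = solve-∀
      c≉0′ : c (L 1 · M) ≉ 0
      c≉0′ c′≈0 = 1≉0 (≈-trans (≈-sym det≈1)
        (≈-by-relations (d M) (- (d M + b M)) (lemma (a M) (b M) (c M) (d M)) (difference≈0 c′≈0) (difference≈0 c≈0)))

    AllU-∪ : 2 ≉ 0 → 3 ≉ 0 → ∀ {S S′} → AllU S k → AllL S k → AllU S′ k → AllU (S ∪ S′) k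
    AllU-∪ 2≉0 3≉0 {S} allU allL allU′ = AllU-from-one (realiser-upper-commutator 2h≈1 diagonal (allU′ 1)) 3≉0
      where
      h = proj₁ (inverse 2 2≉0)
      2h≈1 : 2 * h ≈ 1
      2h≈1 = proj₂ (inverse 2 2≉0)
      diagonal : Realiser S k (mat 2 0 0 h)
      diagonal = realiser-SL₂ allU allL (mat 2 0 0 h) (≈-trans (≡⇒≈ (ℤ.+-identityʳ (2 * h))) 2h≈1)

module Construction (v v′ : ℤ) (v≢v′ : v ≢ v′) {K : ℕ} (p : Fin K → ℕ) (prime : ∀ i → Prime (p i))
                    (large : ∀ i → 5 ⊔ (∣ v - v′ ∣ ℕ.+ 1) ≤ p i) (lam : Fin K → ℤ)
                    (distinct : ∀ i j → p i ≡ p j → i ≢ j → ¬ (lam i ≡ lam j [mod p i ])) where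

  open Subgroup p (S3S-3 p (Sgen lam v v′))

  μ : Fin K → ℤ
  μ i = lam i - v

  e : ℤ
  e = v′ - v

  -- cₙ = sⁿ (s s′⁻¹) s⁻ⁿ for s = T (λ − v) and s′ = T (λ − v′).
  c₀ c₁ c₂ : Tuple K
  c₀ i = U e
  c₁ i = transvection (μ i) 1 e
  c₂ i = transvection (μ i * μ i - 1) (μ i) e

  private
    member-of-word : ∀ {g} b₁ b₂ b₃ b₄ b₅ b₆ →
      (∀ i → (Sgen lam v v′ b₁ ⊙ (Sgen lam v v′ b₂ ⊙ (Sgen lam v v′ b₃ ⊙ (inv (Sgen lam v v′ b₄) ⊙
              (inv (Sgen lam v v′ b₅) ⊙ inv (Sgen lam v v′ b₆)))))) i ≡ g i) →
      (∀ i → det (g i) ≡ 1) → Member g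
    member-of-word b₁ b₂ b₃ b₄ b₅ b₆ word≡g det≡1 =
      gen (b₁ , b₂ , b₃ , b₄ , b₅ , b₆ ,
           λ i → inj₁ (Congruence.≅⇒≡M[mod] (p i) (Congruence.≡⇒≅ (p i) (sym (word≡g i))))) ,
      det≡1

    difference : ∀ i → (lam i - v) - (lam i - v′) ≡ e
    difference i = lemma (lam i) v v′
      where
      lemma : ∀ l v v′ → (l - v) - (l - v′) ≡ v′ - v
      lemma = solve-∀

  c₀∈ : Member c₀
  c₀∈ = member-of-word false true true true true true
         (λ i → trans (word-c₀ (lam i - v) (lam i - v′)) (cong U (difference i))) (λ _ → det-U e)

  c₁∈ : Member c₁
  c₁∈ = member-of-word false false true true true false
         (λ i → trans (word-c₁ (lam i - v) (lam i - v′)) (cong (transvection (μ i) 1) (difference i)))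
         (λ i → det-transvection (μ i) 1 e)

  c₂∈ : Member c₂
  c₂∈ = member-of-word false false false true false false
         (λ i → trans (word-c₂ (lam i - v) (lam i - v′)) (cong (transvection (μ i * μ i - 1) (μ i)) (difference i)))
         (λ i → det-transvection (μ i * μ i - 1) (μ i) e)

  module _ (q : ℕ) (i : Fin K) where
    open Congruence q

    c₀-zpow : ∀ z → zpow c₀ z i ≅ U (z * e)
    c₀-zpow z = ≅-trans (zpow-transvection q i {c₀} (≡⇒≅ (sym (transvection-1-0 e))) z) (≡⇒≅ (transvection-1-0 (z * e)))

    c₁-zpow : ∀ z → zpow c₁ z i ≅ transvection (μ i) 1 (z * e)
    c₁-zpow = zpow-transvection q i {c₁} ≅-refl

    c₂-zpow : ∀ z → zpow c₂ z i ≅ transvection (μ i * μ i - 1) (μ i) (z * e)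
    c₂-zpow = zpow-transvection q i {c₂} ≅-refl

  module AtPrime (k : Fin K) where
    open Congruence (p k)
    open PrimeField (prime k)

    5≤p : 5 ≤ p k
    5≤p = ℕ.≤-trans (ℕ.m≤m⊔n 5 (∣ v - v′ ∣ ℕ.+ 1)) (large k)

    2≉0 : 2 ≉ 0
    2≉0 = ≉0-below (λ ()) (ℕ.≤-trans (ℕ.m≤m+n 3 2) 5≤p)

    3≉0 : 3 ≉ 0
    3≉0 = ≉0-below (λ ()) (ℕ.≤-trans (ℕ.m≤m+n 4 1) 5≤p)

    e≉0 : e ≉ 0
    e≉0 = ≉0-below e≢0 ∣e∣<p
      where
      e≢0 : e ≢ 0
      e≢0 e≡0 = v≢v′ (sym (ℤ.i-j≡0⇒i≡j v′ v e≡0))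
      swap : ∀ v v′ → - (v - v′) ≡ v′ - v
      swap = solve-∀
      ∣e∣<p : ∣ e ∣ ℕ.< p k
      ∣e∣<p = subst (ℕ._< p k) (trans (sym (ℤ.∣-i∣≡∣i∣ (v - v′))) (cong ∣_∣ (swap v v′)))
                (subst (_≤ p k) (ℕ.+-comm ∣ v - v′ ∣ 1) (ℕ.≤-trans (ℕ.m≤n⊔m 5 (∣ v - v′ ∣ ℕ.+ 1)) (large k)))

    ê : ℤ
    ê = proj₁ (inverse e e≉0)

    eê-1≈0 : e * ê - 1 ≈ 0
    eê-1≈0 = difference≈0 (proj₂ (inverse e e≉0))

    ê-cancel : ∀ x → x * ê * e ≈ x
    ê-cancel x = ≈-by-relation x (lemma x ê e) eê-1≈0
      where
      lemma : ∀ x ê e → x * ê * e - x ≡ x * (e * ê - 1)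
      lemma = solve-∀

    c₀-realiser : Realiser ∅ k (U e)
    c₀-realiser = realiser c₀ c₀∈ (λ _ ()) ≅-refl

    AllU-∅ : AllU ∅ k
    AllU-∅ = AllU-from-one (prime k) c₀-realiser e≉0

    -- At k, c₀ʳ c₁ maps (1, 0) to (0, − e), so conjugation by it turns each U into an L.
    AllL-from-AllU-at : ∀ {S} → AllU S k → AllL S k
    AllL-from-AllU-at = AllL-from-AllU (prime k) (member-· (member-zpow c₀∈ r) c₁∈) a≈0 c≈-e -e≉0
      where
      r = (1 - e * μ k) * ê * ê
      Qₖ≅ : zpow c₀ r k · c₁ k ≅ U (r * e) · transvection (μ k) 1 e
      Qₖ≅ = ·-cong (c₀-zpow (p k) k r) ≅-refl
      a-entry : ∀ μ e ê → 1 * (1 - e * μ * 1) + (1 - e * μ) * ê * ê * e * (- (e * 1 * 1)) - 0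
                          ≡ (- (1 - e * μ) * (e * ê + 1)) * (e * ê - 1)
      a-entry = solve-∀
      c-entry : ∀ μ e → 0 * (1 - e * μ * 1) + 1 * (- (e * 1 * 1)) ≡ - e
      c-entry = solve-∀
      a≈0 : a (zpow c₀ r k · c₁ k) ≈ 0
      a≈0 = ≈-trans (a≈ Qₖ≅) (≈-by-relation (- (1 - e * μ k) * (e * ê + 1)) (a-entry (μ k) e ê) eê-1≈0)
      c≈-e : c (zpow c₀ r k · c₁ k) ≈ - e
      c≈-e = ≈-trans (c≈ Qₖ≅) (≡⇒≈ (c-entry (μ k) e))
      -e≉0 : - e ≉ 0
      -e≉0 -e≈0 = e≉0 (subst (_≈ 0) (ℤ.neg-involutive e) (neg-cong -e≈0))

  module DistinctPrimes (j k : Fin K) (pⱼ≢pₖ : p j ≢ p k) where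
    open Congruence (p k)
    open PrimeField (prime k)
    open AtPrime k

    -- c₀ to the power p j is trivial modulo p j but not modulo p k.
    separating : AllU ｛ j ｝ k
    separating = AllU-from-one (prime k) (realiser (zpow c₀ (+ p j)) (member-zpow c₀∈ (+ p j)) trivial-at-j (c₀-zpow (p k) k (+ p j)))
                         (*-≉0 pⱼ≉0 e≉0)
      where
      trivial-at-j : ∀ i → j ≡ i → Trivial i (zpow c₀ (+ p j))
      trivial-at-j _ refl = Congruence.≅-trans (p j) (c₀-zpow (p j) j (+ p j)) (Congruence.U-cong (p j) (Congruence.multiple≈0 (p j) e))
      pⱼ≉0 : + p j ≉ 0
      pⱼ≉0 pⱼ≈0 with prime⇒irreducible (prime j) (≈0⇒∣ pⱼ≈0)
      ... | inj₁ pₖ≡1 = ℕ.nonTrivial⇒≢1 {{prime⇒nonTrivial (prime k)}} pₖ≡1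
      ... | inj₂ pₖ≡pⱼ = pⱼ≢pₖ (sym pₖ≡pⱼ)

  module SamePrime (j k : Fin K) (pⱼ≡pₖ : p j ≡ p k) (j≢k : j ≢ k) where
    open Congruence (p k)
    open PrimeField (prime k)
    open AtPrime k

    Δ : ℤ
    Δ = μ k - μ j

    Δ≉0 : Δ ≉ 0
    Δ≉0 Δ≈0 = distinct k j (sym pⱼ≡pₖ) (λ k≡j → j≢k (sym k≡j))
                (≈⇒≡[mod] {lam k} {lam j} (≈-by-relation 1 (lemma (lam k) (lam j) v) (difference≈0 Δ≈0)))
      where
      lemma : ∀ l l′ v → l - l′ ≡ 1 * ((l - v) - (l′ - v) - 0)
      lemma = solve-∀

    Δ̂ : ℤ
    Δ̂ = proj₁ (inverse (2 * Δ) (*-≉0 2≉0 Δ≉0))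

    2ΔΔ̂≈1 : 2 * Δ * Δ̂ ≈ 1
    2ΔΔ̂≈1 = proj₂ (inverse (2 * Δ) (*-≉0 2≉0 Δ≉0))

    q : ℤ
    q = μ j - 2 * μ k

    -- At every index i, A and B are transvections along (μ i + Δ̂, 1) and (μ i² − 1 + q μ i, μ i + q);
    -- these vectors are proportional only for μ i = μ j, and there the parameters match too.
    A B W : Tuple K
    A = conj (zpow c₀ (Δ̂ * ê)) (zpow c₁ (- 6 * Δ * ê))
    B = conj (zpow c₁ (q * ê)) (zpow c₂ (- 3 * Δ̂ * ê))
    W = B ⊙ inv A

    A∈ : Member A
    A∈ = member-conj (member-zpow c₀∈ (Δ̂ * ê)) (member-zpow c₁∈ (- 6 * Δ * ê))

    W∈ : Member W
    W∈ = member-· (member-conj (member-zpow c₁∈ (q * ê)) (member-zpow c₂∈ (- 3 * Δ̂ * ê))) (member-inv {A} A∈)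

    A-component : ∀ i → A i ≅ transvection (μ i + Δ̂) 1 (- 6 * Δ)
    A-component i = begin
      A i
        ≈⟨ conj-cong (≅-trans (c₀-zpow (p k) i (Δ̂ * ê)) (U-cong (ê-cancel Δ̂)))
                     (≅-trans (c₁-zpow (p k) i (- 6 * Δ * ê)) (transvection-cong ≈-refl ≈-refl (ê-cancel (- 6 * Δ)))) ⟩
      U Δ̂ · (transvection (μ i) 1 (- 6 * Δ) · adj (U Δ̂))
        ≡⟨ conj-U Δ̂ (μ i) 1 (- 6 * Δ) ⟩
      transvection (μ i + Δ̂ * 1) 1 (- 6 * Δ)
        ≡⟨ cong (λ x → transvection (μ i + x) 1 (- 6 * Δ)) (ℤ.*-identityʳ Δ̂) ⟩
      transvection (μ i + Δ̂) 1 (- 6 * Δ) ∎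
      where open ≅-Reasoning

    B-component : ∀ i → B i ≅ transvection (μ i * μ i - 1 + q * μ i) (μ i + q) (- 3 * Δ̂)
    B-component i = begin
      B i
        ≈⟨ conj-cong (≅-trans (c₁-zpow (p k) i (q * ê)) (transvection-cong ≈-refl ≈-refl (ê-cancel q)))
                     (≅-trans (c₂-zpow (p k) i (- 3 * Δ̂ * ê)) (transvection-cong ≈-refl ≈-refl (ê-cancel (- 3 * Δ̂)))) ⟩
      transvection (μ i) 1 q · (transvection (μ i * μ i - 1) (μ i) (- 3 * Δ̂) · adj (transvection (μ i) 1 q))
        ≡⟨ conj-transvection (transvection (μ i) 1 q) (μ i * μ i - 1) (μ i) (- 3 * Δ̂) (det-transvection (μ i) 1 q) ⟩
      transvection ((1 - q * μ i * 1) * (μ i * μ i - 1) + q * μ i * μ i * μ i)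
                   ((- (q * 1 * 1)) * (μ i * μ i - 1) + (1 + q * μ i * 1) * μ i) (- 3 * Δ̂)
        ≡⟨ cong₂ (λ g h → transvection g h (- 3 * Δ̂)) (first (μ i) q) (second (μ i) q) ⟩
      transvection (μ i * μ i - 1 + q * μ i) (μ i + q) (- 3 * Δ̂) ∎
      where
      open ≅-Reasoning
      first : ∀ μ q → (1 - q * μ * 1) * (μ * μ - 1) + q * μ * μ * μ ≡ μ * μ - 1 + q * μ
      first = solve-∀
      second : ∀ μ q → (- (q * 1 * 1)) * (μ * μ - 1) + (1 + q * μ * 1) * μ ≡ μ + q
      second = solve-∀

    W-trivial : Trivial j W
    W-trivial = subst (λ m → W j ≅ I₂ [mod m ]) (sym pⱼ≡pₖ) (begin
      B j · adj (A j)  ≈⟨ ·-cong Bⱼ≅Aⱼ (≅-refl {adj (A j)}) ⟩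
      A j · adj (A j)  ≡⟨ adj-inverseʳ (A j) (proj₂ A∈ j) ⟩
      I₂               ∎)
      where
      open ≅-Reasoning
      κ = - 2 * Δ
      first : ∀ μj μk D → μj * μj - 1 + (μj - 2 * μk) * μj - (- 2 * (μk - μj)) * (μj + D) ≡ 1 * (2 * (μk - μj) * D - 1)
      first = solve-∀
      second : ∀ μj μk → μj + (μj - 2 * μk) ≡ - 2 * (μk - μj) * 1
      second = solve-∀
      third : ∀ Δ D → - 2 * Δ * (- 2 * Δ) * (- 3 * D) - (- 6 * Δ) ≡ - 6 * Δ * (2 * Δ * D - 1)
      third = solve-∀
      vector≈ : μ j * μ j - 1 + q * μ j ≈ κ * (μ j + Δ̂)
      vector≈ = ≈-by-relation 1 (first (μ j) (μ k) Δ̂) (difference≈0 2ΔΔ̂≈1)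
      parameter≈ : κ * κ * (- 3 * Δ̂) ≈ - 6 * Δ
      parameter≈ = ≈-by-relation (- 6 * Δ) (third Δ Δ̂) (difference≈0 2ΔΔ̂≈1)
      Bⱼ≅Aⱼ : B j ≅ A j
      Bⱼ≅Aⱼ = begin
        B j                                                   ≈⟨ B-component j ⟩
        transvection (μ j * μ j - 1 + q * μ j) (μ j + q) (- 3 * Δ̂)
          ≈⟨ transvection-cong vector≈ (≡⇒≈ (second (μ j) (μ k))) (≈-refl { - 3 * Δ̂ }) ⟩
        transvection (κ * (μ j + Δ̂)) (κ * 1) (- 3 * Δ̂)       ≡⟨ transvection-scale κ (μ j + Δ̂) 1 (- 3 * Δ̂) ⟩
        transvection (μ j + Δ̂) 1 (κ * κ * (- 3 * Δ̂))         ≈⟨ transvection-cong ≈-refl ≈-refl parameter≈ ⟩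
        transvection (μ j + Δ̂) 1 (- 6 * Δ)                   ≈⟨ ≅-sym (A-component j) ⟩
        A j                                                   ∎

    x₁ t₁ x₂ t₂ : ℤ
    x₁ = μ k + 2 * Δ̂
    t₁ = (- Δ) * (- Δ) * (- 3 * Δ̂)
    x₂ = μ k + Δ̂
    t₂ = - (- 6 * Δ)

    Wₖ≅ : W k ≅ transvection x₁ 1 t₁ · transvection x₂ 1 t₂
    Wₖ≅ = ·-cong Bₖ≅ (≅-trans (adj-cong (A-component k)) (≡⇒≅ (adj-transvection x₂ 1 (- 6 * Δ))))
      where
      open ≅-Reasoning
      first : ∀ μj μk D → μk * μk - 1 + (μj - 2 * μk) * μk - (- (μk - μj)) * (μk + 2 * D) ≡ 1 * (2 * (μk - μj) * D - 1)
      first = solve-∀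
      second : ∀ μj μk → μk + (μj - 2 * μk) ≡ - (μk - μj) * 1
      second = solve-∀
      Bₖ≅ : B k ≅ transvection x₁ 1 t₁
      Bₖ≅ = begin
        B k                                                   ≈⟨ B-component k ⟩
        transvection (μ k * μ k - 1 + q * μ k) (μ k + q) (- 3 * Δ̂)
          ≈⟨ transvection-cong (≈-by-relation 1 (first (μ j) (μ k) Δ̂) (difference≈0 2ΔΔ̂≈1))
                               (≡⇒≈ (second (μ j) (μ k))) (≈-refl { - 3 * Δ̂ }) ⟩
        transvection ((- Δ) * x₁) ((- Δ) * 1) (- 3 * Δ̂)     ≡⟨ transvection-scale (- Δ) x₁ 1 (- 3 * Δ̂) ⟩
        transvection x₁ 1 t₁                                 ∎

    -- The cofactors come from reducing the entries of the product in Wₖ≅ modulo 2ΔΔ̂ − 1.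
    Wₖ-triangular : W k ≅ mat 4 (b (W k)) 0 (d (W k)) × 4 * d (W k) ≈ 1
    Wₖ-triangular = triangular (≈-trans (a≈ Wₖ≅) a≈4) (≈-trans (c≈ Wₖ≅) c≈0) (≡⇒≈ (proj₂ W∈ k))
      where
      a-entry : ∀ μ Δ D →
        (1 - (- Δ) * (- Δ) * (- 3 * D) * (μ + 2 * D) * 1) * (1 - (- (- 6 * Δ)) * (μ + D) * 1)
          + (- Δ) * (- Δ) * (- 3 * D) * (μ + 2 * D) * (μ + 2 * D) * (- ((- (- 6 * Δ)) * 1 * 1)) - 4
        ≡ (3 + 12 * Δ * D + 18 * Δ * Δ * D * D + 6 * μ * Δ + 9 * μ * Δ * Δ * D) * (2 * Δ * D - 1)
      a-entry = solve-∀
      c-entry : ∀ μ Δ D →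
        (- ((- Δ) * (- Δ) * (- 3 * D) * 1 * 1)) * (1 - (- (- 6 * Δ)) * (μ + D) * 1)
          + (1 + (- Δ) * (- Δ) * (- 3 * D) * (μ + 2 * D) * 1) * (- ((- (- 6 * Δ)) * 1 * 1)) - 0
        ≡ (6 * Δ + 9 * Δ * Δ * D) * (2 * Δ * D - 1)
      c-entry = solve-∀
      a≈4 : a (transvection x₁ 1 t₁ · transvection x₂ 1 t₂) ≈ 4
      a≈4 = ≈-by-relation (3 + 12 * Δ * Δ̂ + 18 * Δ * Δ * Δ̂ * Δ̂ + 6 * μ k * Δ + 9 * μ k * Δ * Δ * Δ̂)
                          (a-entry (μ k) Δ Δ̂) (difference≈0 2ΔΔ̂≈1)
      c≈0 : c (transvection x₁ 1 t₁ · transvection x₂ 1 t₂) ≈ 0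
      c≈0 = ≈-by-relation (6 * Δ + 9 * Δ * Δ * Δ̂) (c-entry (μ k) Δ Δ̂) (difference≈0 2ΔΔ̂≈1)

    W-realiser : Realiser ｛ j ｝ k (mat 4 (b (W k)) 0 (d (W k)))
    W-realiser = realiser W W∈ (λ { _ refl → W-trivial }) (proj₁ Wₖ-triangular)

    separating-p≢5 : p k ≢ 5 → AllU ｛ j ｝ k
    separating-p≢5 pₖ≢5 = AllU-from-one (prime k) commutator-with-c₀ parameter≉0
      where
      commutator-with-c₀ : Realiser ｛ j ｝ k (U (4 * 4 * e - e))
      commutator-with-c₀ = realiser-weaken inj₁
        (realiser-upper-commutator (proj₂ Wₖ-triangular) W-realiser c₀-realiser)
      5≉0 : 5 ≉ 0
      5≉0 5≈0 = pₖ≢5 (ℕ.≤-antisym (ℕ.∣⇒≤ (≈0⇒∣ 5≈0)) 5≤p)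
      lemma : ∀ e → 3 * 5 * e ≡ 4 * 4 * e - e
      lemma = solve-∀
      parameter≉0 : 4 * 4 * e - e ≉ 0
      parameter≉0 parameter≈0 = *-≉0 (*-≉0 3≉0 5≉0) e≉0 (≈-trans (≡⇒≈ (lemma e)) parameter≈0)

    Wₖ≅mod5 : 5 ≈ 0 → W k ≅ mat 4 (- 2 * Δ̂) 0 4
    Wₖ≅mod5 5≈0 = ≅-trans (proj₁ Wₖ-triangular) (entrywise ≈-refl b≈-2Δ̂ ≈-refl d≈4)
      where
      5-0≈0 : 5 - 0 ≈ 0
      5-0≈0 = difference≈0 5≈0
      4≉0 : 4 ≉ 0
      4≉0 = ≉0-below (λ ()) 5≤p
      b-entry : ∀ μ Δ D →
        4 * ((1 - (- Δ) * (- Δ) * (- 3 * D) * (μ + 2 * D) * 1) * ((- (- 6 * Δ)) * (μ + D) * (μ + D))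
             + (- Δ) * (- Δ) * (- 3 * D) * (μ + 2 * D) * (μ + 2 * D) * (1 + (- (- 6 * Δ)) * (μ + D) * 1))
          - 4 * (- 2 * D)
        ≡ ((- 18) * D + (- 60) * Δ * D * D + (- 72) * Δ * Δ * D * D * D + (- 15) * μ + (- 78) * μ * Δ * D
           + (- 108) * μ * Δ * Δ * D * D + (- 24) * μ * μ * Δ + (- 36) * μ * μ * Δ * Δ * D) * (2 * Δ * D - 1)
          + ((- 2) * D + (- 3) * μ) * (5 - 0)
      b-entry = solve-∀
      b≈-2Δ̂ : b (W k) ≈ - 2 * Δ̂
      b≈-2Δ̂ = *-cancelˡ 4≉0 (≈-trans (*-cong (≈-refl {4}) (b≈ Wₖ≅))
             (≈-by-relations ((- 18) * Δ̂ + (- 60) * Δ * Δ̂ * Δ̂ + (- 72) * Δ * Δ * Δ̂ * Δ̂ * Δ̂ + (- 15) * μ k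
                              + (- 78) * μ k * Δ * Δ̂ + (- 108) * μ k * Δ * Δ * Δ̂ * Δ̂ + (- 24) * μ k * μ k * Δ
                              + (- 36) * μ k * μ k * Δ * Δ * Δ̂)
                             ((- 2) * Δ̂ + (- 3) * μ k) (b-entry (μ k) Δ Δ̂) (difference≈0 2ΔΔ̂≈1) 5-0≈0))
      d-entry : ∀ δ → δ - 4 ≡ 4 * (4 * δ - 1) + (- 3 * δ) * (5 - 0)
      d-entry = solve-∀
      d≈4 : d (W k) ≈ 4
      d≈4 = ≈-by-relations 4 (- 3 * d (W k)) (d-entry (d (W k))) (difference≈0 (proj₂ Wₖ-triangular)) 5-0≈0

    -- Modulo 5 the diagonal entries 4 of Wₖ equal −1, so W² is unipotent at k.
    separating-p≡5 : p k ≡ 5 → AllU ｛ j ｝ k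
    separating-p≡5 pₖ≡5 = AllU-from-one (prime k)
      (realiser (W ⊙ W) (member-· W∈ W∈) (λ { _ refl → trivial-· {j} {W} {W} W-trivial W-trivial }) W²ₖ≅U) -Δ̂≉0
      where
      5≈0 : 5 ≈ 0
      5≈0 = subst (λ m → + m ≈ 0) pₖ≡5 modulus≈0
      5-0≈0 : 5 - 0 ≈ 0
      5-0≈0 = difference≈0 5≈0
      diagonal : ∀ β → 4 * 4 + β * 0 - 1 ≡ 3 * (5 - 0)
      diagonal = solve-∀
      diagonal′ : ∀ β → 0 * β + 4 * 4 - 1 ≡ 3 * (5 - 0)
      diagonal′ = solve-∀
      off-diagonal : ∀ D → 4 * (- 2 * D) + (- 2 * D) * 4 - (- D) ≡ (- 3 * D) * (5 - 0)
      off-diagonal = solve-∀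
      W²ₖ≅U : W k · W k ≅ U (- Δ̂)
      W²ₖ≅U = ≅-trans (·-cong (Wₖ≅mod5 5≈0) (Wₖ≅mod5 5≈0))
        (entrywise (≈-by-relation 3 (diagonal (- 2 * Δ̂)) 5-0≈0) (≈-by-relation (- 3 * Δ̂) (off-diagonal Δ̂) 5-0≈0)
                   ≈-refl (≈-by-relation 3 (diagonal′ (- 2 * Δ̂)) 5-0≈0))
      lemma : ∀ x y → x * y - 0 ≡ (- x) * (- y - 0)
      lemma = solve-∀
      -Δ̂≉0 : - Δ̂ ≉ 0
      -Δ̂≉0 -Δ̂≈0 = 1≉0 (≈-trans (≈-sym 2ΔΔ̂≈1) (≈-by-relation (- (2 * Δ)) (lemma (2 * Δ) Δ̂) (difference≈0 -Δ̂≈0)))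

    separating : AllU ｛ j ｝ k
    separating with p k ℕ.≟ 5
    ... | yes pₖ≡5 = separating-p≡5 pₖ≡5
    ... | no pₖ≢5 = separating-p≢5 pₖ≢5

  separating : ∀ j k → j ≢ k → AllU ｛ j ｝ k
  separating j k j≢k with p j ℕ.≟ p k
  ... | yes pⱼ≡pₖ = SamePrime.separating j k pⱼ≡pₖ j≢k
  ... | no pⱼ≢pₖ = DistinctPrimes.separating j k pⱼ≢pₖ

  localise : ∀ k J → AllU ((_∈ J) ∖ ｛ k ｝) k
  localise k [] s = realiser-weaken (λ { (() , _) }) (AtPrime.AllU-∅ k s)
  localise k (j ∷ J) s with k Fin.≟ j
  ... | yes refl = realiser-weaken drop-k (localise k J s)
    where
    drop-k : (_∈ k ∷ J) ∖ ｛ k ｝ ⊆ (_∈ J) ∖ ｛ k ｝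
    drop-k (here refl , k≢k) = ⊥-elim (k≢k refl)
    drop-k (there i∈J , k≢i) = i∈J , k≢i
  ... | no k≢j = realiser-weaken split (AllU-∪ (prime k) 2≉0 3≉0 separating-j (AllL-from-AllU-at separating-j) (localise k J) s)
    where
    open AtPrime k
    separating-j = separating j k (λ j≡k → k≢j (sym j≡k))
    split : (_∈ j ∷ J) ∖ ｛ k ｝ ⊆ ｛ j ｝ ∪ ((_∈ J) ∖ ｛ k ｝)
    split (here refl , _) = inj₁ refl
    split (there i∈J , k≢i) = inj₂ (i∈J , k≢i)

  supported-realiser : ∀ k M → det M ≈ 1 [mod p k ] → Realiser (∁ ｛ k ｝) k M
  supported-realiser k M det≈1 = realiser-SL₂ (prime k) allU (AtPrime.AllL-from-AllU-at k allU) M det≈1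
    where
    allU : AllU (∁ ｛ k ｝) k
    allU s = realiser-weaken (λ {j} k≢j → ∈-allFin j , k≢j) (localise k (allFin K) s)

  S³S⁻³-generates : ∀ g → InProduct p g → Gen p (S3S-3 p (Sgen lam v v′)) g
  S³S⁻³-generates g g∈ = generated-by-realisers (λ k → supported-realiser k (g k) (Congruence.≡[mod]⇒≈ (p k) (g∈ k)))

-- D Aᵀ D with D = diag(1, −1).
twisted-transpose : M₂ → M₂
twisted-transpose (mat x y z w) = mat x (- z) (- y) w

twisted-transpose-· : ∀ A B → twisted-transpose (A · B) ≡ twisted-transpose B · twisted-transpose A
twisted-transpose-· (mat a₁ b₁ c₁ d₁) (mat a₂ b₂ c₂ d₂) =
  mat-cong (a-entry a₁ b₁ a₂ c₂) (b-entry c₁ d₁ a₂ c₂) (c-entry a₁ b₁ b₂ d₂) (d-entry c₁ d₁ b₂ d₂)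
  where
  a-entry : ∀ x y u w → x * u + y * w ≡ u * x + (- w) * (- y)
  a-entry = solve-∀
  b-entry : ∀ x y u w → - (x * u + y * w) ≡ u * (- x) + (- w) * y
  b-entry = solve-∀
  c-entry : ∀ x y u w → - (x * u + y * w) ≡ (- u) * x + w * (- y)
  c-entry = solve-∀
  d-entry : ∀ x y u w → x * u + y * w ≡ (- u) * (- x) + w * y
  d-entry = solve-∀

twisted-transpose-involutive : ∀ A → twisted-transpose (twisted-transpose A) ≡ A
twisted-transpose-involutive (mat x y z w) = mat-cong refl (ℤ.neg-involutive y) (ℤ.neg-involutive z) refl

det-twisted-transpose : ∀ A → det (twisted-transpose A) ≡ det A
det-twisted-transpose (mat x y z w) = lemma x y z w
  where
  lemma : ∀ x y z w → x * w - (- z) * (- y) ≡ x * w - y * z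
  lemma = solve-∀

twisted-transpose-reverses : ∀ A B C D E F →
  twisted-transpose (A · (B · (C · (D · (E · F))))) ≡
  twisted-transpose F · (twisted-transpose E · (twisted-transpose D · (twisted-transpose C · (twisted-transpose B · twisted-transpose A))))
twisted-transpose-reverses A B C D E F = begin
  τ (A · (B · (C · (D · (E · F)))))                ≡⟨ τ-· A _ ⟩
  τ (B · (C · (D · (E · F)))) · τ A                ≡⟨ cong (_· τ A) (τ-· B _) ⟩
  (τ (C · (D · (E · F))) · τ B) · τ A              ≡⟨ cong (λ X → (X · τ B) · τ A) (τ-· C _) ⟩
  ((τ (D · (E · F)) · τ C) · τ B) · τ A            ≡⟨ cong (λ X → ((X · τ C) · τ B) · τ A) (τ-· D _) ⟩
  (((τ (E · F) · τ D) · τ C) · τ B) · τ A          ≡⟨ cong (λ X → (((X · τ D) · τ C) · τ B) · τ A) (τ-· E F) ⟩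
  ((((τ F · τ E) · τ D) · τ C) · τ B) · τ A        ≡⟨ ·-assoc (((τ F · τ E) · τ D) · τ C) (τ B) (τ A) ⟩
  (((τ F · τ E) · τ D) · τ C) · (τ B · τ A)        ≡⟨ ·-assoc ((τ F · τ E) · τ D) (τ C) (τ B · τ A) ⟩
  ((τ F · τ E) · τ D) · (τ C · (τ B · τ A))        ≡⟨ ·-assoc (τ F · τ E) (τ D) (τ C · (τ B · τ A)) ⟩
  (τ F · τ E) · (τ D · (τ C · (τ B · τ A)))        ≡⟨ ·-assoc (τ F) (τ E) (τ D · (τ C · (τ B · τ A))) ⟩
  τ F · (τ E · (τ D · (τ C · (τ B · τ A))))        ∎
  where
  open ≡-Reasoning
  τ = twisted-transpose
  τ-· = twisted-transpose-·

module _ (q : ℕ) where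
  open Congruence q

  twisted-transpose-cong : ∀ {A B} → A ≅ B → twisted-transpose A ≅ twisted-transpose B
  twisted-transpose-cong {mat _ _ _ _} {mat _ _ _ _} (entrywise a≈ b≈ c≈ d≈) = entrywise a≈ (neg-cong c≈) (neg-cong b≈) d≈

  twisted-transpose-≈P : ∀ {A B} → A ≈P B [mod q ] → twisted-transpose A ≈P twisted-transpose B [mod q ]
  twisted-transpose-≈P {A} {B} (inj₁ A≡B) = inj₁ (≅⇒≡M[mod] (twisted-transpose-cong (≡M[mod]⇒≅ {A} {B} A≡B)))
  twisted-transpose-≈P {A} {B@(mat _ _ _ _)} (inj₂ A≡-B) =
    inj₂ (≅⇒≡M[mod] (twisted-transpose-cong (≡M[mod]⇒≅ {A} {neg B} A≡-B)))

module _ {K : ℕ} (p : Fin K → ℕ) (s : Bool → Tuple K) (s-fixed : ∀ b i → twisted-transpose (s b i) ≡ s b i) where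

  twist : Tuple K → Tuple K
  twist g i = twisted-transpose (g i)

  private
    ≡⇒≈[in] : ∀ {g h} → (∀ i → g i ≡ h i) → g ≈ h [in p ]
    ≡⇒≈[in] g≡h i = inj₁ (Congruence.≅⇒≡M[mod] (p i) (Congruence.≡⇒≅ (p i) (g≡h i)))

  twist-generated : ∀ {g} → Gen p (S3S-3 p s) g → Gen p (S-3S3 p s) (twist g)
  twist-generated {g} (gen (b₁ , b₂ , b₃ , b₄ , b₅ , b₆ , g≈word)) =
    gen (b₆ , b₅ , b₄ , b₃ , b₂ , b₁ ,
         λ i → subst (λ W → twist g i ≈P W [mod p i ]) (reversed i) (twisted-transpose-≈P (p i) {g i} (g≈word i)))
    where
    fixed-inv : ∀ b i → twisted-transpose (adj (s b i)) ≡ adj (s b i)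
    fixed-inv b i = cong adj (s-fixed b i)
    reversed : ∀ i → twisted-transpose ((s b₁ ⊙ (s b₂ ⊙ (s b₃ ⊙ (inv (s b₄) ⊙ (inv (s b₅) ⊙ inv (s b₆)))))) i)
                     ≡ (inv (s b₆) ⊙ (inv (s b₅) ⊙ (inv (s b₄) ⊙ (s b₃ ⊙ (s b₂ ⊙ s b₁))))) i
    reversed i = trans (twisted-transpose-reverses (s b₁ i) (s b₂ i) (s b₃ i) (adj (s b₄ i)) (adj (s b₅ i)) (adj (s b₆ i)))
      (cong₂ _·_ (fixed-inv b₆ i) (cong₂ _·_ (fixed-inv b₅ i) (cong₂ _·_ (fixed-inv b₄ i)
        (cong₂ _·_ (s-fixed b₃ i) (cong₂ _·_ (s-fixed b₂ i) (s-fixed b₁ i))))))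
  twist-generated gone = gone
  twist-generated (gmul {g} {h} g∈ h∈) =
    gresp (≡⇒≈[in] (λ i → sym (twisted-transpose-· (g i) (h i)))) (gmul (twist-generated h∈) (twist-generated g∈))
  twist-generated (ginv g∈) = ginv (twist-generated g∈)
  twist-generated (gresp {g} {h} g≈h g∈) = gresp (λ i → twisted-transpose-≈P (p i) {g i} {h i} (g≈h i)) (twist-generated g∈)

  twist-generates : (∀ g → InProduct p g → Gen p (S3S-3 p s) g) → ∀ g → InProduct p g → Gen p (S-3S3 p s) g
  twist-generates S³S⁻³-all g g∈ =
    gresp (≡⇒≈[in] (λ i → twisted-transpose-involutive (g i)))
          (twist-generated (S³S⁻³-all (twist g) (λ i → subst (λ δ → δ ≡ 1 [mod p i ]) (sym (det-twisted-transpose (g i))) (g∈ i))))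

lemma6 : (v v' : ℤ) → v ≢ v' →
    (k : ℕ) (p : Fin k → ℕ) → (∀ i → Prime (p i)) →
    (∀ i j → i ≤ᶠ j → p j ≤ p i) →
    (∀ i → 5 ⊔ (∣ v - v' ∣ Data.Nat.+ 1) ≤ p i) →
    (lam : Fin k → ℤ) →
    (∀ i j → p i ≡ p j → i ≢ j → ¬ (lam i ≡ lam j [mod p i ])) →
    (∀ g → InProduct p g → Gen p (S3S-3 p (Sgen lam v v')) g)
    × (∀ g → InProduct p g → Gen p (S-3S3 p (Sgen lam v v')) g)
lemma6 v v′ v≢v′ k p prime _ large lam distinct =
  S³S⁻³-generates , twist-generates p (Sgen lam v v′) (λ { false _ → refl ; true _ → refl }) S³S⁻³-generates
  where open Construction v v′ v≢v′ p prime large lam distinct using (S³S⁻³-generates)
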